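{- Let $o$ be a $\lambda\mu\mathtt{s}$-object. If $o\to^{+}_{\mathtt{w}}\to_{\overline{\lambda\mu\mathtt{s}}}o'$ (one or more $\mathtt{w}$-steps followed by one non-erasing step), then $o\to_{\overline{\lambda\mu\mathtt{s}}}\to^{+}_{\mathtt{w}}o'$ (one non-erasing step followed by one or more $\mathtt{w}$-steps).
   Context: The $\lambda\mu\mathtt{s}$-calculus. Variables $x,y,\dots$, names $\alpha,\beta,\gamma,\dots$. Terms $t,u ::= x \mid \lambda x.t \mid t\,u \mid \mu\alpha.c \mid t[x/u]$; commands $c ::= [\alpha]t \mid c\langle\alpha/\!\!/\beta.u\rangle$; objects $o::=t\mid c$. $t[x/u]$ binds $x$ in $t$; $c\langle\alpha/\!\!/\beta.u\rangle$ binds $\alpha$ in $c$: $\mathrm{fv}(t[x/u])=(\mathrm{fv}(t)\setminus\{x\})\cup\mathrm{fv}(u)$, $\mathrm{fn}(c\langle\alpha/\!\!/\beta.u\rangle)=(\mathrm{fn}(c)\setminus\{\alpha\})\cup\{\beta\}\cup\mathrm{fn}(u)$; $\lambda x$ binds $x$, $\mu\alpha$ binds $\alpha$, $\mathrm{fn}([\alpha]t)=\mathrm{fn}(t)\cup\{\alpha\}$; objects up to renaming of bound symbols. $|o|_x$, $|o|_\alpha$ count free occurrences. Contexts: $\mathtt{L}::=\Box\mid\mathtt{L}[x/u]$; $\mathtt{TT}::=\Box\mid\lambda x.\mathtt{TT}\mid\mathtt{TT}\,t\mid t\,\mathtt{TT}\mid\mu\alpha.\mathtt{CT}\mid\mathtt{TT}[x/t]\mid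 t[x/\mathtt{TT}]$, $\mathtt{CT}::=[\alpha]\mathtt{TT}\mid\mathtt{CT}\langle\alpha/\!\!/\beta.u\rangle\mid c\langle\alpha/\!\!/\beta.\mathtt{TT}\rangle$; $\mathtt{TC}::=\lambda x.\mathtt{TC}\mid\mathtt{TC}\,t\mid t\,\mathtt{TC}\mid\mu\alpha.\mathtt{CC}\mid\mathtt{TC}[x/t]\mid t[x/\mathtt{TC}]$, $\mathtt{CC}::=\boxdot\mid[\alpha]\mathtt{TC}\mid\mathtt{CC}\langle\alpha/\!\!/\beta.u\rangle\mid c\langle\alpha/\!\!/\beta.\mathtt{TC}\rangle$. The rules: (B) $\mathtt{L}[\lambda x.t]\,u\to\mathtt{L}[t[x/u]]$; (c$_v$) $\mathtt{TT}[x][x/u]\to\mathtt{TT}[u][x/u]$ if $|\mathtt{TT}[x]|_x>1$; (d$_v$) $\mathtt{TT}[x][x/u]\to\mathtt{TT}[u]$ if $|\mathtt{TT}[x]|_x=1$; (w$_v$) $t[x/u]\to t$ if $x\notin\mathrm{fv}(t)$; (M) $\mathtt{L}[\mu\alpha.c]\,u\to\mathtt{L}[\mu\gamma.c\langle\alpha/\!\!/\gamma.u\rangle]$, $\gamma$ fresh; (c$_n$) $\mathtt{CC}[[\alpha]t]\langle\alpha/\!\!/\gamma.u\rangle\to\mathtt{CC}[[\gamma]t\,u]\langle\alpha/\!\!/\gamma.u\rangle$ if $|\mathtt{CC}[[\alpha]t]|_\alpha>1$; (d$_n$) $\mathtt{CC}[[\alpha]t]\langle\alpha/\!\!/\gamma.u\rangle\to\mathtt{CC}[[\gamma]t\,u]$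 if $|\mathtt{CC}[[\alpha]t]|_\alpha=1$; (w$_n$) $c\langle\alpha/\!\!/\gamma.u\rangle\to c$ if $\alpha\notin\mathrm{fn}(c)$; $\mathtt{TT}$ does not bind $x$, $\mathtt{CC}$ does not bind $\alpha,\gamma$. $\to_{\mathtt{w}}$ is the closure under all contexts of (w$_v$) and (w$_n$); $\to_{\overline{\lambda\mu\mathtt{s}}}$ is the closure under all contexts of the remaining six rules (the non-erasing reduction). -}

module Defs where

open import Data.Nat using (ℕ; zero; suc; _+_; _≤_)
open import Data.Fin using (Fin; zero; suc)
open import Function using (id; _∘_)
open import Relation.Binary.Construct.Closure.Transitive using (TransClosure)
open import Data.Product using (∃; _×_)
open import Relation.Binary.PropositionalEquality using (_≡_)

-- Syntax of the λμs-calculus, well-scoped de Bruijn representation.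
-- Obj s n m : objects of sort s (term / command) whose free variables
-- lie in Fin n and whose free names lie in Fin m.  Bound symbols are
-- de Bruijn index zero, so objects are automatically taken up to
-- renaming of bound symbols.

data Sort : Set where
  tm cm : Sort

data Obj : Sort → ℕ → ℕ → Set where
  var   : ∀ {n m} → Fin n → Obj tm n m
  lam   : ∀ {n m} → Obj tm (suc n) m → Obj tm n m
  app   : ∀ {n m} → Obj tm n m → Obj tm n m → Obj tm n m
  mu    : ∀ {n m} → Obj cm n (suc m) → Obj tm n m
  es    : ∀ {n m} → Obj tm (suc n) m → Obj tm n m → Obj tm n m
  named : ∀ {n m} → Fin m → Obj tm n m → Obj cm n m
  rs    : ∀ {n m} → Obj cm n (suc m) → Fin m → Obj tm n m → Obj cm n m
          -- c⟨α//β.u⟩ : α (index zero) bound in c; β free; u free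

liftF : ∀ {a b} → (Fin a → Fin b) → Fin (suc a) → Fin (suc b)
liftF ρ zero    = zero
liftF ρ (suc i) = suc (ρ i)

ren : ∀ {s n n' m m'} → (Fin n → Fin n') → (Fin m → Fin m') →
      Obj s n m → Obj s n' m'
ren ρ σ (var x)     = var (ρ x)
ren ρ σ (lam t)     = lam (ren (liftF ρ) σ t)
ren ρ σ (app t u)   = app (ren ρ σ t) (ren ρ σ u)
ren ρ σ (mu c)      = mu (ren ρ (liftF σ) c)
ren ρ σ (es t u)    = es (ren (liftF ρ) σ t) (ren ρ σ u)
ren ρ σ (named α t) = named (σ α) (ren ρ σ t)
ren ρ σ (rs c β u)  = rs (ren ρ (liftF σ) c) (σ β) (ren ρ σ u)

liftS : ∀ {n n' m} → (Fin n → Obj tm n' m) → Fin (suc n) → Obj tm (suc n') m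
liftS θ zero    = var zero
liftS θ (suc i) = ren suc id (θ i)

liftSN : ∀ {n n' m} → (Fin n → Obj tm n' m) → Fin n → Obj tm n' (suc m)
liftSN θ i = ren id suc (θ i)

subst : ∀ {s n n' m} → (Fin n → Obj tm n' m) → Obj s n m → Obj s n' m
subst θ (var x)     = θ x
subst θ (lam t)     = lam (subst (liftS θ) t)
subst θ (app t u)   = app (subst θ t) (subst θ u)
subst θ (mu c)      = mu (subst (liftSN θ) c)
subst θ (es t u)    = es (subst (liftS θ) t) (subst θ u)
subst θ (named α t) = named α (subst θ t)
subst θ (rs c β u)  = rs (subst (liftSN θ) c) β (subst θ u)

single : ∀ {n m} → Obj tm n m → Fin (suc n) → Obj tm n m
single u zero    = u
single u (suc i) = var i

singleN : ∀ {m} → Fin m → Fin (suc m) → Fin m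
singleN γ zero    = γ
singleN γ (suc i) = i

eqCount : ∀ {n} → Fin n → Fin n → ℕ
eqCount zero    zero    = 1
eqCount zero    (suc _) = 0
eqCount (suc _) zero    = 0
eqCount (suc i) (suc j) = eqCount i j

countV : ∀ {s n m} → Obj s n m → Fin n → ℕ
countV (var y)     x = eqCount y x
countV (lam t)     x = countV t (suc x)
countV (app t u)   x = countV t x + countV u x
countV (mu c)      x = countV c x
countV (es t u)    x = countV t (suc x) + countV u x
countV (named α t) x = countV t x
countV (rs c β u)  x = countV c x + countV u x

countN : ∀ {s n m} → Obj s n m → Fin m → ℕ
countN (var y)     α = 0
countN (lam t)     α = countN t α
countN (app t u)   α = countN t α + countN u α
countN (mu c)      α = countN c (suc α)
countN (es t u)    α = countN t α + countN u α
countN (named β t) α = eqCount β α + countN t α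
countN (rs c β u)  α = countN c (suc α) + eqCount β α + countN u α

-- Ctx s n m s' n' m' : a context of outer sort s and scope
-- (n , m) whose hole has sort s' and scope (n' , m').  With s' = tm this
-- is TT (s = tm) / CT (s = cm); with s' = cm it is TC / CC.  Plugging
-- captures: vEmb / nEmb say where the outer free symbols are seen at the
-- hole (so a symbol of the outer scope is never bound by the context).

data Ctx : Sort → ℕ → ℕ → Sort → ℕ → ℕ → Set where
  hole   : ∀ {s n m} → Ctx s n m s n m
  lamC   : ∀ {n m s' n' m'} → Ctx tm (suc n) m s' n' m' → Ctx tm n m s' n' m'
  appL   : ∀ {n m s' n' m'} → Ctx tm n m s' n' m' → Obj tm n m → Ctx tm n m s' n' m'
  appR   : ∀ {n m s' n' m'} → Obj tm n m → Ctx tm n m s' n' m' → Ctx tm n m s' n' m'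
  muC    : ∀ {n m s' n' m'} → Ctx cm n (suc m) s' n' m' → Ctx tm n m s' n' m'
  esL    : ∀ {n m s' n' m'} → Ctx tm (suc n) m s' n' m' → Obj tm n m → Ctx tm n m s' n' m'
  esR    : ∀ {n m s' n' m'} → Obj tm (suc n) m → Ctx tm n m s' n' m' → Ctx tm n m s' n' m'
  namedC : ∀ {n m s' n' m'} → Fin m → Ctx tm n m s' n' m' → Ctx cm n m s' n' m'
  rsL    : ∀ {n m s' n' m'} → Ctx cm n (suc m) s' n' m' → Fin m → Obj tm n m → Ctx cm n m s' n' m'
  rsR    : ∀ {n m s' n' m'} → Obj cm n (suc m) → Fin m → Ctx tm n m s' n' m' → Ctx cm n m s' n' m'

plug : ∀ {s n m s' n' m'} → Ctx s n m s' n' m' → Obj s' n' m' → Obj s n m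
plug hole         o = o
plug (lamC C)     o = lam (plug C o)
plug (appL C u)   o = app (plug C o) u
plug (appR t C)   o = app t (plug C o)
plug (muC C)      o = mu (plug C o)
plug (esL C u)    o = es (plug C o) u
plug (esR t C)    o = es t (plug C o)
plug (namedC α C) o = named α (plug C o)
plug (rsL C β u)  o = rs (plug C o) β u
plug (rsR c β C)  o = rs c β (plug C o)

vEmb : ∀ {s n m s' n' m'} → Ctx s n m s' n' m' → Fin n → Fin n'
vEmb hole         = id
vEmb (lamC C)     = vEmb C ∘ suc
vEmb (appL C u)   = vEmb C
vEmb (appR t C)   = vEmb C
vEmb (muC C)      = vEmb C
vEmb (esL C u)    = vEmb C ∘ suc
vEmb (esR t C)    = vEmb C
vEmb (namedC α C) = vEmb C
vEmb (rsL C β u)  = vEmb C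
vEmb (rsR c β C)  = vEmb C

nEmb : ∀ {s n m s' n' m'} → Ctx s n m s' n' m' → Fin m → Fin m'
nEmb hole         = id
nEmb (lamC C)     = nEmb C
nEmb (appL C u)   = nEmb C
nEmb (appR t C)   = nEmb C
nEmb (muC C)      = nEmb C ∘ suc
nEmb (esL C u)    = nEmb C
nEmb (esR t C)    = nEmb C
nEmb (namedC α C) = nEmb C
nEmb (rsL C β u)  = nEmb C ∘ suc
nEmb (rsR c β C)  = nEmb C

data LCtx : ℕ → ℕ → ℕ → Set where
  □L   : ∀ {n m} → LCtx n n m
  _[_] : ∀ {n n' m} → LCtx (suc n) n' m → Obj tm n m → LCtx n n' m

plugL : ∀ {n n' m} → LCtx n n' m → Obj tm n' m → Obj tm n m
plugL □L      t = t
plugL (L [ u ]) t = es (plugL L t) u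

wkL : ∀ {n n' m} → LCtx n n' m → Fin n → Fin n'
wkL □L        = id
wkL (L [ u ]) = wkL L ∘ suc

data RootNE : ∀ {s n m} → Obj s n m → Obj s n m → Set where
  B  : ∀ {n n' m} (L : LCtx n n' m) (t : Obj tm (suc n') m) (u : Obj tm n m) →
       RootNE (app (plugL L (lam t)) u) (plugL L (es t (ren (wkL L) id u)))
  cv : ∀ {n m n' m'} (C : Ctx tm (suc n) m tm n' m') (u : Obj tm n m) →
       2 ≤ countV (plug C (var (vEmb C zero))) zero →
       RootNE (es (plug C (var (vEmb C zero))) u)
              (es (plug C (ren (vEmb C ∘ suc) (nEmb C) u)) u)
  dv : ∀ {n m n' m'} (C : Ctx tm (suc n) m tm n' m') (u : Obj tm n m) →
       countV (plug C (var (vEmb C zero))) zero ≡ 1 →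
       RootNE (es (plug C (var (vEmb C zero))) u)
              (subst (single u) (plug C (var (vEmb C zero))))
  M  : ∀ {n n' m} (L : LCtx n n' m) (c : Obj cm n' (suc m)) (u : Obj tm n m) →
       RootNE (app (plugL L (mu c)) u)
              (plugL L (mu (rs (ren id (liftF suc) c) zero (ren (wkL L) suc u))))
  cn : ∀ {n m n' m'} (C : Ctx cm n (suc m) cm n' m') (t : Obj tm n' m')
       (γ : Fin m) (u : Obj tm n m) →
       2 ≤ countN (plug C (named (nEmb C zero) t)) zero →
       RootNE (rs (plug C (named (nEmb C zero) t)) γ u)
              (rs (plug C (named (nEmb C (suc γ)) (app t (ren (vEmb C) (nEmb C ∘ suc) u)))) γ u)
  dn : ∀ {n m n' m'} (C : Ctx cm n (suc m) cm n' m') (t : Obj tm n' m')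
       (γ : Fin m) (u : Obj tm n m) →
       countN (plug C (named (nEmb C zero) t)) zero ≡ 1 →
       RootNE (rs (plug C (named (nEmb C zero) t)) γ u)
              (ren id (singleN γ)
                 (plug C (named (nEmb C (suc γ)) (app t (ren (vEmb C) (nEmb C ∘ suc) u)))))

-- the erasing rules w_v, w_n:  x ∉ fv(t) is expressed by t being a
-- weakening of an object of the smaller scope (likewise for α ∉ fn(c))
data RootW : ∀ {s n m} → Obj s n m → Obj s n m → Set where
  wv : ∀ {n m} (t : Obj tm n m) (u : Obj tm n m) →
       RootW (es (ren suc id t) u) t
  wn : ∀ {n m} (c : Obj cm n m) (γ : Fin m) (u : Obj tm n m) →
       RootW (rs (ren id suc c) γ u) c

data CtxClos (R : ∀ {s n m} → Obj s n m → Obj s n m → Set) :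
     ∀ {s n m} → Obj s n m → Obj s n m → Set where
  ctx : ∀ {s n m s' n' m'} (C : Ctx s n m s' n' m') {a b : Obj s' n' m'} →
        R a b → CtxClos R (plug C a) (plug C b)

_→w_ : ∀ {s n m} → Obj s n m → Obj s n m → Set
_→w_ = CtxClos RootW

_→ne_ : ∀ {s n m} → Obj s n m → Obj s n m → Set
_→ne_ = CtxClos RootNE

_→w⁺_ : ∀ {s n m} → Obj s n m → Obj s n m → Set
_→w⁺_ = TransClosure _→w_

module Submission where

-- It suffices to swap ONE w-step with the following
-- non-erasing step, producing one non-erasing step followed by at least
-- one w-step (`swap`); iterating from the last w-step backwards gives the
-- lemma (`swap⁺`).  To analyse how the two steps overlap, both are put in
-- a structural form (`Step`, equivalent to the context closure of Defs),
-- so that they can be matched simultaneously: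
--   * disjoint positions commute directly;
--   * an erasing root step w_v / w_n is postponed by performing the other
--     step under the substitution it erases (renaming lemmas);
--   * a w-step inside a non-erasing redex keeps the redex a redex.  For
--     B / M this is an inversion on list contexts (`headB-⇐w`); for the
--     context rules c_v, d_v, c_n, d_n we describe "replace one occurrence"
--     by the relations `Rep` / `RepN`, which commute with w-steps, and use
--     that w-steps never increase occurrence counts.  The only delicate
--     case is a linear d_v / d_n redex whose source is not linear: it is
--     fired as c_v / c_n and the leftover substitution is erased by w.

open import Defs
open import Data.Product using (∃; _×_; _,_)
open import Data.Sum using (inj₁; inj₂)
open import Data.Nat using (ℕ; zero; suc; _+_; _≤_; s≤s)
open import Data.Nat.Properties
  using (m+n≡0⇒m≡0; m+n≡0⇒n≡0; ≤-trans; +-mono-≤; ≤-refl; m≤m+n; m≤n+m; ≤-reflexive;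
         +-identityʳ; +-suc; suc-injective; m≤n⇒m<n∨m≡n)
open import Data.Fin using (Fin; zero; suc)
open import Function using (id; _∘_)
open import Relation.Binary.PropositionalEquality
  using (_≡_; refl; sym; trans; cong; cong₂; subst₂; module ≡-Reasoning)
  renaming (subst to transport)
open import Relation.Binary.Construct.Closure.Transitive using (TransClosure; _∷_; _++_) renaming ([_] to [_]⁺)

-- Renaming algebra.  Renamings act on variables and names separately;
-- the laws below are stated for pointwise-equal renamings, since
-- `liftF` only commutes with composition pointwise.

liftF-fusion : ∀ {a b d} {ρ₁ : Fin a → Fin b} {ρ₂ : Fin b → Fin d} {ρ : Fin a → Fin d} →
  (∀ i → ρ₂ (ρ₁ i) ≡ ρ i) → ∀ i → liftF ρ₂ (liftF ρ₁ i) ≡ liftF ρ i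
liftF-fusion e zero    = refl
liftF-fusion e (suc i) = cong suc (e i)

ren-fusion : ∀ {s n₁ n₂ n₃ m₁ m₂ m₃} {ρ₁ : Fin n₁ → Fin n₂} {ρ₂ : Fin n₂ → Fin n₃} {ρ : Fin n₁ → Fin n₃}
  {σ₁ : Fin m₁ → Fin m₂} {σ₂ : Fin m₂ → Fin m₃} {σ : Fin m₁ → Fin m₃} →
  (∀ i → ρ₂ (ρ₁ i) ≡ ρ i) → (∀ j → σ₂ (σ₁ j) ≡ σ j) → (X : Obj s n₁ m₁) →
  ren ρ₂ σ₂ (ren ρ₁ σ₁ X) ≡ ren ρ σ X
ren-fusion e f (var x)     = cong var (e x)
ren-fusion e f (lam t)     = cong lam (ren-fusion (liftF-fusion e) f t)
ren-fusion e f (app t u)   = cong₂ app (ren-fusion e f t) (ren-fusion e f u)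
ren-fusion e f (mu c)      = cong mu (ren-fusion e (liftF-fusion f) c)
ren-fusion e f (es t u)    = cong₂ es (ren-fusion (liftF-fusion e) f t) (ren-fusion e f u)
ren-fusion e f (named α t) = cong₂ named (f α) (ren-fusion e f t)
ren-fusion e f (rs c β u) rewrite f β =
  cong₂ (λ c' u' → rs c' _ u') (ren-fusion e (liftF-fusion f) c) (ren-fusion e f u)

ren-∘ : ∀ {s n₁ n₂ n₃ m₁ m₂ m₃} (ρ₁ : Fin n₁ → Fin n₂) (ρ₂ : Fin n₂ → Fin n₃)
  (σ₁ : Fin m₁ → Fin m₂) (σ₂ : Fin m₂ → Fin m₃) (X : Obj s n₁ m₁) →
  ren ρ₂ σ₂ (ren ρ₁ σ₁ X) ≡ ren (ρ₂ ∘ ρ₁) (σ₂ ∘ σ₁) X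
ren-∘ ρ₁ ρ₂ σ₁ σ₂ = ren-fusion (λ _ → refl) (λ _ → refl)

ren-square : ∀ {s n₁ n₂ n₃ n₂' m₁ m₂ m₃ m₂'} {ρ₁ : Fin n₁ → Fin n₂} {ρ₂ : Fin n₂ → Fin n₃}
  {ρ₃ : Fin n₁ → Fin n₂'} {ρ₄ : Fin n₂' → Fin n₃}
  {σ₁ : Fin m₁ → Fin m₂} {σ₂ : Fin m₂ → Fin m₃} {σ₃ : Fin m₁ → Fin m₂'} {σ₄ : Fin m₂' → Fin m₃} →
  (∀ i → ρ₂ (ρ₁ i) ≡ ρ₄ (ρ₃ i)) → (∀ j → σ₂ (σ₁ j) ≡ σ₄ (σ₃ j)) → (X : Obj s n₁ m₁) →
  ren ρ₂ σ₂ (ren ρ₁ σ₁ X) ≡ ren ρ₄ σ₄ (ren ρ₃ σ₃ X)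
ren-square e f X = trans (ren-fusion e f X) (sym (ren-∘ _ _ _ _ X))

liftF-id : ∀ {a} {ρ : Fin a → Fin a} → (∀ i → ρ i ≡ i) → ∀ i → liftF ρ i ≡ i
liftF-id e zero    = refl
liftF-id e (suc i) = cong suc (e i)

ren-id : ∀ {s n m} {ρ : Fin n → Fin n} {σ : Fin m → Fin m} →
  (∀ i → ρ i ≡ i) → (∀ j → σ j ≡ j) → (X : Obj s n m) → ren ρ σ X ≡ X
ren-id e f (var x)     = cong var (e x)
ren-id e f (lam t)     = cong lam (ren-id (liftF-id e) f t)
ren-id e f (app t u)   = cong₂ app (ren-id e f t) (ren-id e f u)
ren-id e f (mu c)      = cong mu (ren-id e (liftF-id f) c)
ren-id e f (es t u)    = cong₂ es (ren-id (liftF-id e) f t) (ren-id e f u)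
ren-id e f (named α t) = cong₂ named (f α) (ren-id e f t)
ren-id e f (rs c β u) rewrite f β =
  cong₂ (λ c' u' → rs c' _ u') (ren-id e (liftF-id f) c) (ren-id e f u)

ren-id-id : ∀ {s n m} (X : Obj s n m) → ren id id X ≡ X
ren-id-id = ren-id (λ _ → refl) (λ _ → refl)

module _ {n n' N n₀ m K} {ρ : Fin n' → Fin N} {σ : Fin m → Fin K}
         {θ : Fin n → Obj tm n' m} {ρ₀ : Fin n → Fin n₀} {θ' : Fin n₀ → Obj tm N K}
         (e : ∀ i → ren ρ σ (θ i) ≡ θ' (ρ₀ i)) where

  ren-liftS : ∀ i → ren (liftF ρ) σ (liftS θ i) ≡ liftS θ' (liftF ρ₀ i)
  ren-liftS zero    = refl
  ren-liftS (suc i) = trans (ren-square (λ _ → refl) (λ _ → refl) (θ i)) (cong (ren suc id) (e i))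

  ren-liftSN : ∀ i → ren ρ (liftF σ) (liftSN θ i) ≡ liftSN θ' (ρ₀ i)
  ren-liftSN i = trans (ren-square (λ _ → refl) (λ _ → refl) (θ i)) (cong (ren id suc) (e i))

ren-subst : ∀ {s n n' N n₀ m K} {ρ : Fin n' → Fin N} {σ : Fin m → Fin K}
  {θ : Fin n → Obj tm n' m} {ρ₀ : Fin n → Fin n₀} {θ' : Fin n₀ → Obj tm N K} →
  (∀ i → ren ρ σ (θ i) ≡ θ' (ρ₀ i)) → (X : Obj s n m) →
  ren ρ σ (subst θ X) ≡ subst θ' (ren ρ₀ σ X)
ren-subst e (var x)     = e x
ren-subst {ρ₀ = ρ₀} {θ'} e (lam t) = cong lam (ren-subst (ren-liftS {ρ₀ = ρ₀} {θ' = θ'} e) t)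
ren-subst e (app t u)   = cong₂ app (ren-subst e t) (ren-subst e u)
ren-subst {ρ₀ = ρ₀} {θ'} e (mu c) = cong mu (ren-subst (ren-liftSN {ρ₀ = ρ₀} {θ' = θ'} e) c)
ren-subst {ρ₀ = ρ₀} {θ'} e (es t u) =
  cong₂ es (ren-subst (ren-liftS {ρ₀ = ρ₀} {θ' = θ'} e) t) (ren-subst e u)
ren-subst e (named α t) = cong (named _) (ren-subst e t)
ren-subst {ρ₀ = ρ₀} {θ'} e (rs c β u) =
  cong₂ (λ c' u' → rs c' _ u') (ren-subst (ren-liftSN {ρ₀ = ρ₀} {θ' = θ'} e) c) (ren-subst e u)

module _ {n n₁ n' n₀ K} {ρ : Fin n → Fin n₁} {θ : Fin n₁ → Obj tm n' K}
         {ρ₀ : Fin n → Fin n₀} {θ' : Fin n₀ → Obj tm n' K}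
         (e : ∀ i → θ (ρ i) ≡ θ' (ρ₀ i)) where

  liftS-ren : ∀ i → liftS θ (liftF ρ i) ≡ liftS θ' (liftF ρ₀ i)
  liftS-ren zero    = refl
  liftS-ren (suc i) = cong (ren suc id) (e i)

  liftSN-ren : ∀ i → liftSN θ (ρ i) ≡ liftSN θ' (ρ₀ i)
  liftSN-ren i = cong (ren id suc) (e i)

subst-ren : ∀ {s n n₁ n' n₀ m K} {ρ : Fin n → Fin n₁} {σ : Fin m → Fin K}
  {θ : Fin n₁ → Obj tm n' K} {ρ₀ : Fin n → Fin n₀} {θ' : Fin n₀ → Obj tm n' K} →
  (∀ i → θ (ρ i) ≡ θ' (ρ₀ i)) → (X : Obj s n m) →
  subst θ (ren ρ σ X) ≡ subst θ' (ren ρ₀ σ X)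
subst-ren e (var x)     = e x
subst-ren {ρ = ρ} {θ = θ} {ρ₀ = ρ₀} {θ'} e (lam t) =
  cong lam (subst-ren (liftS-ren {ρ = ρ} {θ = θ} {ρ₀ = ρ₀} {θ' = θ'} e) t)
subst-ren e (app t u)   = cong₂ app (subst-ren e t) (subst-ren e u)
subst-ren {ρ = ρ} {θ = θ} {ρ₀ = ρ₀} {θ'} e (mu c) =
  cong mu (subst-ren (liftSN-ren {ρ = ρ} {θ = θ} {ρ₀ = ρ₀} {θ' = θ'} e) c)
subst-ren {ρ = ρ} {θ = θ} {ρ₀ = ρ₀} {θ'} e (es t u) =
  cong₂ es (subst-ren (liftS-ren {ρ = ρ} {θ = θ} {ρ₀ = ρ₀} {θ' = θ'} e) t) (subst-ren e u)
subst-ren e (named α t) = cong (named _) (subst-ren e t)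
subst-ren {ρ = ρ} {θ = θ} {ρ₀ = ρ₀} {θ'} e (rs c β u) =
  cong₂ (λ c' u' → rs c' _ u') (subst-ren (liftSN-ren {ρ = ρ} {θ = θ} {ρ₀ = ρ₀} {θ' = θ'} e) c) (subst-ren e u)

subst-weakenV : ∀ {s n n' m} (θ : Fin n → Obj tm n' m) (X : Obj s n m) →
  subst (liftS θ) (ren suc id X) ≡ ren suc id (subst θ X)
subst-weakenV θ X = trans (subst-ren {ρ₀ = id} (λ _ → refl) X) (sym (ren-subst {ρ₀ = id} (λ _ → refl) X))

subst-weakenN : ∀ {s n n' m} (θ : Fin n → Obj tm n' m) (X : Obj s n m) →
  subst (liftSN θ) (ren id suc X) ≡ ren id suc (subst θ X)
subst-weakenN θ X = trans (subst-ren {ρ₀ = id} (λ _ → refl) X) (sym (ren-subst {ρ₀ = id} (λ _ → refl) X))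

-- The compatible closure of a root relation, presented structurally (one
-- constructor per way of entering an immediate subobject).  It coincides
-- with the context closure `CtxClos` of Defs, and lets the overlap
-- analysis below proceed by matching two steps on the same object.

RootRel : Set₁
RootRel = ∀ {s n m} → Obj s n m → Obj s n m → Set

data Step (R : RootRel) : RootRel where
  root   : ∀ {s n m} {a b : Obj s n m} → R a b → Step R a b
  lamₛ   : ∀ {n m} {t t' : Obj tm (suc n) m} → Step R t t' → Step R (lam t) (lam t')
  appˡ   : ∀ {n m} {t t' u : Obj tm n m} → Step R t t' → Step R (app t u) (app t' u)
  appʳ   : ∀ {n m} {t u u' : Obj tm n m} → Step R u u' → Step R (app t u) (app t u')
  muₛ    : ∀ {n m} {c c' : Obj cm n (suc m)} → Step R c c' → Step R (mu c) (mu c')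
  esˡ    : ∀ {n m} {t t' : Obj tm (suc n) m} {u} → Step R t t' → Step R (es t u) (es t' u)
  esʳ    : ∀ {n m} {t : Obj tm (suc n) m} {u u'} → Step R u u' → Step R (es t u) (es t u')
  namedₛ : ∀ {n m} {α : Fin m} {t t' : Obj tm n m} → Step R t t' → Step R (named α t) (named α t')
  rsˡ    : ∀ {n m} {c c' : Obj cm n (suc m)} {β u} → Step R c c' → Step R (rs c β u) (rs c' β u)
  rsʳ    : ∀ {n m} {c : Obj cm n (suc m)} {β} {u u' : Obj tm n m} → Step R u u' → Step R (rs c β u) (rs c β u')

_⇒w_ _⇒ne_ : RootRel
_⇒w_  = Step RootW
_⇒ne_ = Step RootNE

_⇒w⁺_ : RootRel
_⇒w⁺_ = TransClosure _⇒w_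

plug-step : ∀ {R : RootRel} {s n m s' n' m'} (C : Ctx s n m s' n' m') {a b} → Step R a b → Step R (plug C a) (plug C b)
plug-step hole         r = r
plug-step (lamC C)     r = lamₛ (plug-step C r)
plug-step (appL C u)   r = appˡ (plug-step C r)
plug-step (appR t C)   r = appʳ (plug-step C r)
plug-step (muC C)      r = muₛ (plug-step C r)
plug-step (esL C u)    r = esˡ (plug-step C r)
plug-step (esR t C)    r = esʳ (plug-step C r)
plug-step (namedC α C) r = namedₛ (plug-step C r)
plug-step (rsL C β u)  r = rsˡ (plug-step C r)
plug-step (rsR c β C)  r = rsʳ (plug-step C r)

plugL-step : ∀ {R : RootRel} {n n' m} (L : LCtx n n' m) {a b} → Step R a b → Step R (plugL L a) (plugL L b)
plugL-step □L        r = r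
plugL-step (L [ u ]) r = esˡ (plugL-step L r)

-- The two presentations of the compatible closure agree: a structural
-- step records the path to its redex, which is exactly a context.
ctx→step : ∀ {R : RootRel} {s n m} {a b : Obj s n m} → CtxClos R a b → Step R a b
ctx→step (ctx C r) = plug-step C (root r)

step→ctx : ∀ {R : RootRel} {s n m} {a b : Obj s n m} → Step R a b → CtxClos R a b
step→ctx (root r) = ctx hole r
step→ctx (lamₛ r) with step→ctx r
... | ctx C r' = ctx (lamC C) r'
step→ctx (appˡ r) with step→ctx r
... | ctx C r' = ctx (appL C _) r'
step→ctx (appʳ r) with step→ctx r
... | ctx C r' = ctx (appR _ C) r'
step→ctx (muₛ r) with step→ctx r
... | ctx C r' = ctx (muC C) r'
step→ctx (esˡ r) with step→ctx r
... | ctx C r' = ctx (esL C _) r'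
step→ctx (esʳ r) with step→ctx r
... | ctx C r' = ctx (esR _ C) r'
step→ctx (namedₛ r) with step→ctx r
... | ctx C r' = ctx (namedC _ C) r'
step→ctx (rsˡ r) with step→ctx r
... | ctx C r' = ctx (rsL C _ _) r'
step→ctx (rsʳ r) with step→ctx r
... | ctx C r' = ctx (rsR _ _ C) r'

plus-map : ∀ {A : Set} {R S : A → A → Set} →
  (∀ {x y} → R x y → S x y) → ∀ {x y} → TransClosure R x y → TransClosure S x y
plus-map g [ r ]⁺    = [ g r ]⁺
plus-map g (r ∷ rs⁺) = g r ∷ plus-map g rs⁺

RenStable : RootRel → Set
RenStable R = ∀ {s n m N K} {X Y : Obj s n m} (ρ : Fin n → Fin N) (σ : Fin m → Fin K) →
  R X Y → R (ren ρ σ X) (ren ρ σ Y)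

ren-step : ∀ {R : RootRel} → RenStable R → RenStable (Step R)
ren-step f ρ σ (root r)   = root (f ρ σ r)
ren-step f ρ σ (lamₛ r)   = lamₛ (ren-step f (liftF ρ) σ r)
ren-step f ρ σ (appˡ r)   = appˡ (ren-step f ρ σ r)
ren-step f ρ σ (appʳ r)   = appʳ (ren-step f ρ σ r)
ren-step f ρ σ (muₛ r)    = muₛ (ren-step f ρ (liftF σ) r)
ren-step f ρ σ (esˡ r)    = esˡ (ren-step f (liftF ρ) σ r)
ren-step f ρ σ (esʳ r)    = esʳ (ren-step f ρ σ r)
ren-step f ρ σ (namedₛ r) = namedₛ (ren-step f ρ σ r)
ren-step f ρ σ (rsˡ r)    = rsˡ (ren-step f ρ (liftF σ) r)
ren-step f ρ σ (rsʳ r)    = rsʳ (ren-step f ρ σ r)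

ren-rootW : RenStable RootW
ren-rootW ρ σ (wv t u) =
  transport (λ z → RootW (es z (ren ρ σ u)) (ren ρ σ t)) (ren-square (λ _ → refl) (λ _ → refl) t)
    (wv (ren ρ σ t) (ren ρ σ u))
ren-rootW ρ σ (wn c γ u) =
  transport (λ z → RootW (rs z (σ γ) (ren ρ σ u)) (ren ρ σ c)) (ren-square (λ _ → refl) (λ _ → refl) c)
    (wn (ren ρ σ c) (σ γ) (ren ρ σ u))

ren-⇒w : RenStable _⇒w_
ren-⇒w = ren-step ren-rootW

eqCount-refl : ∀ {n} (x : Fin n) → eqCount x x ≡ 1
eqCount-refl zero    = refl
eqCount-refl (suc x) = eqCount-refl x

eqCount≡1 : ∀ {n} (y x : Fin n) → eqCount y x ≡ 1 → y ≡ x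
eqCount≡1 zero    zero    _ = refl
eqCount≡1 (suc y) (suc x) h = cong suc (eqCount≡1 y x h)

liftF-eqCount : ∀ {n n'} {ρ : Fin n → Fin n'} {x : Fin n} {x' : Fin n'} →
  (∀ j → eqCount (ρ j) x' ≡ eqCount j x) → ∀ j → eqCount (liftF ρ j) (suc x') ≡ eqCount j (suc x)
liftF-eqCount e zero    = refl
liftF-eqCount e (suc j) = e j

liftF-eqCount-zero : ∀ {n n'} (ρ : Fin n → Fin n') j → eqCount (liftF ρ j) zero ≡ eqCount j zero
liftF-eqCount-zero ρ zero    = refl
liftF-eqCount-zero ρ (suc j) = refl

countV-ren : ∀ {s n n' m m'} {ρ : Fin n → Fin n'} {σ : Fin m → Fin m'} {x x'} →
  (∀ j → eqCount (ρ j) x' ≡ eqCount j x) → (X : Obj s n m) → countV (ren ρ σ X) x' ≡ countV X x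
countV-ren e (var y)     = e y
countV-ren e (lam t)     = countV-ren (liftF-eqCount e) t
countV-ren e (app t u)   = cong₂ _+_ (countV-ren e t) (countV-ren e u)
countV-ren e (mu c)      = countV-ren e c
countV-ren e (es t u)    = cong₂ _+_ (countV-ren (liftF-eqCount e) t) (countV-ren e u)
countV-ren e (named α t) = countV-ren e t
countV-ren e (rs c β u)  = cong₂ _+_ (countV-ren e c) (countV-ren e u)

countN-ren : ∀ {s n n' m m'} {ρ : Fin n → Fin n'} {σ : Fin m → Fin m'} {α α'} →
  (∀ j → eqCount (σ j) α' ≡ eqCount j α) → (X : Obj s n m) → countN (ren ρ σ X) α' ≡ countN X α
countN-ren e (var y)     = refl
countN-ren e (lam t)     = countN-ren e t
countN-ren e (app t u)   = cong₂ _+_ (countN-ren e t) (countN-ren e u)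
countN-ren e (mu c)      = countN-ren (liftF-eqCount e) c
countN-ren e (es t u)    = cong₂ _+_ (countN-ren e t) (countN-ren e u)
countN-ren e (named α t) = cong₂ _+_ (e α) (countN-ren e t)
countN-ren e (rs c β u)  = cong₂ _+_ (cong₂ _+_ (countN-ren (liftF-eqCount e) c) (e β)) (countN-ren e u)

liftF-fresh : ∀ {m m'} {σ : Fin m → Fin m'} {α' : Fin m'} →
  (∀ j → eqCount (σ j) α' ≡ 0) → ∀ j → eqCount (liftF σ j) (suc α') ≡ 0
liftF-fresh e zero    = refl
liftF-fresh e (suc j) = e j

countN-ren-fresh : ∀ {s n n' m m'} {ρ : Fin n → Fin n'} {σ : Fin m → Fin m'} {α'} →
  (∀ j → eqCount (σ j) α' ≡ 0) → (X : Obj s n m) → countN (ren ρ σ X) α' ≡ 0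
countN-ren-fresh e (var y)     = refl
countN-ren-fresh e (lam t)     = countN-ren-fresh e t
countN-ren-fresh e (app t u)   = cong₂ _+_ (countN-ren-fresh e t) (countN-ren-fresh e u)
countN-ren-fresh e (mu c)      = countN-ren-fresh (liftF-fresh e) c
countN-ren-fresh e (es t u)    = cong₂ _+_ (countN-ren-fresh e t) (countN-ren-fresh e u)
countN-ren-fresh e (named α t) = cong₂ _+_ (e α) (countN-ren-fresh e t)
countN-ren-fresh e (rs c β u)  =
  cong₂ _+_ (cong₂ _+_ (countN-ren-fresh (liftF-fresh e) c) (e β)) (countN-ren-fresh e u)

countV-⇒w : ∀ {s n m} {X Y : Obj s n m} → X ⇒w Y → ∀ x → countV Y x ≤ countV X x
countV-⇒w (root (wv t u)) x   = ≤-trans (≤-reflexive (sym (countV-ren (λ _ → refl) t))) (m≤m+n _ _)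
countV-⇒w (root (wn c γ u)) x = ≤-trans (≤-reflexive (sym (countV-ren (λ _ → refl) c))) (m≤m+n _ _)
countV-⇒w (lamₛ r) x          = countV-⇒w r (suc x)
countV-⇒w (appˡ r) x          = +-mono-≤ (countV-⇒w r x) ≤-refl
countV-⇒w (appʳ {t = t} r) x  = +-mono-≤ (≤-refl {countV t x}) (countV-⇒w r x)
countV-⇒w (muₛ r) x           = countV-⇒w r x
countV-⇒w (esˡ r) x           = +-mono-≤ (countV-⇒w r (suc x)) ≤-refl
countV-⇒w (esʳ {t = t} r) x   = +-mono-≤ (≤-refl {countV t (suc x)}) (countV-⇒w r x)
countV-⇒w (namedₛ r) x        = countV-⇒w r x
countV-⇒w (rsˡ r) x           = +-mono-≤ (countV-⇒w r x) ≤-refl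
countV-⇒w (rsʳ {c = c} r) x   = +-mono-≤ (≤-refl {countV c x}) (countV-⇒w r x)

countN-⇒w : ∀ {s n m} {X Y : Obj s n m} → X ⇒w Y → ∀ α → countN Y α ≤ countN X α
countN-⇒w (root (wv t u)) α   = ≤-trans (≤-reflexive (sym (countN-ren (λ _ → refl) t))) (m≤m+n _ _)
countN-⇒w (root (wn c γ u)) α =
  ≤-trans (≤-reflexive (sym (countN-ren (λ _ → refl) c))) (≤-trans (m≤m+n _ _) (m≤m+n _ _))
countN-⇒w (lamₛ r) α                  = countN-⇒w r α
countN-⇒w (appˡ r) α                  = +-mono-≤ (countN-⇒w r α) ≤-refl
countN-⇒w (appʳ {t = t} r) α          = +-mono-≤ (≤-refl {countN t α}) (countN-⇒w r α)
countN-⇒w (muₛ r) α                   = countN-⇒w r (suc α)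
countN-⇒w (esˡ r) α                   = +-mono-≤ (countN-⇒w r α) ≤-refl
countN-⇒w (esʳ {t = t} r) α           = +-mono-≤ (≤-refl {countN t α}) (countN-⇒w r α)
countN-⇒w (namedₛ {α = β} r) α        = +-mono-≤ (≤-refl {eqCount β α}) (countN-⇒w r α)
countN-⇒w (rsˡ r) α                   = +-mono-≤ (+-mono-≤ (countN-⇒w r (suc α)) ≤-refl) ≤-refl
countN-⇒w (rsʳ {c = c} {β = β} r) α   = +-mono-≤ (≤-refl {countN c (suc α) + eqCount β α}) (countN-⇒w r α)

subst-⇒w : ∀ {s n m n'} (θ : Fin n → Obj tm n' m) {X Y : Obj s n m} → X ⇒w Y → subst θ X ⇒w subst θ Y
subst-⇒w θ (root (wv t u)) =
  root (transport (λ z → RootW (es z (subst θ u)) (subst θ t)) (sym (subst-weakenV θ t)) (wv (subst θ t) (subst θ u)))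
subst-⇒w θ (root (wn c γ u)) =
  root (transport (λ z → RootW (rs z γ (subst θ u)) (subst θ c)) (sym (subst-weakenN θ c)) (wn (subst θ c) γ (subst θ u)))
subst-⇒w θ (lamₛ r)   = lamₛ (subst-⇒w (liftS θ) r)
subst-⇒w θ (appˡ r)   = appˡ (subst-⇒w θ r)
subst-⇒w θ (appʳ r)   = appʳ (subst-⇒w θ r)
subst-⇒w θ (muₛ r)    = muₛ (subst-⇒w (liftSN θ) r)
subst-⇒w θ (esˡ r)    = esˡ (subst-⇒w (liftS θ) r)
subst-⇒w θ (esʳ r)    = esʳ (subst-⇒w θ r)
subst-⇒w θ (namedₛ r) = namedₛ (subst-⇒w θ r)
subst-⇒w θ (rsˡ r)    = rsˡ (subst-⇒w (liftSN θ) r)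
subst-⇒w θ (rsʳ r)    = rsʳ (subst-⇒w θ r)

AgreeExcept : ∀ {n n' m} → Fin n → (Fin n → Obj tm n' m) → (Fin n → Obj tm n' m) → Set
AgreeExcept x θ₀ θ₁ = ∀ y → eqCount y x ≡ 0 → θ₀ y ≡ θ₁ y

agree-liftS : ∀ {n n' m} {x : Fin n} {θ₀ θ₁ : Fin n → Obj tm n' m} →
  AgreeExcept x θ₀ θ₁ → AgreeExcept (suc x) (liftS θ₀) (liftS θ₁)
agree-liftS e zero    h = refl
agree-liftS e (suc y) h = cong (ren suc id) (e y h)

agree-liftSN : ∀ {n n' m} {x : Fin n} {θ₀ θ₁ : Fin n → Obj tm n' m} →
  AgreeExcept x θ₀ θ₁ → AgreeExcept x (liftSN θ₀) (liftSN θ₁)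
agree-liftSN e y h = cong (ren id suc) (e y h)

subst-agree : ∀ {s n n' m} {x : Fin n} {θ₀ θ₁ : Fin n → Obj tm n' m} → AgreeExcept x θ₀ θ₁ →
  (X : Obj s n m) → countV X x ≡ 0 → subst θ₀ X ≡ subst θ₁ X
subst-agree e (var y) h     = e y h
subst-agree e (lam t) h     = cong lam (subst-agree (agree-liftS e) t h)
subst-agree e (app t u) h   = cong₂ app (subst-agree e t (m+n≡0⇒m≡0 _ h)) (subst-agree e u (m+n≡0⇒n≡0 _ h))
subst-agree e (mu c) h      = cong mu (subst-agree (agree-liftSN e) c h)
subst-agree e (es t u) h    =
  cong₂ es (subst-agree (agree-liftS e) t (m+n≡0⇒m≡0 _ h)) (subst-agree e u (m+n≡0⇒n≡0 _ h))
subst-agree e (named α t) h = cong (named α) (subst-agree e t h)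
subst-agree e (rs c β u) h  =
  cong₂ (λ c' u' → rs c' β u') (subst-agree (agree-liftSN e) c (m+n≡0⇒m≡0 _ h)) (subst-agree e u (m+n≡0⇒n≡0 _ h))

data OneOf (a b : ℕ) : Set where
  inLeft  : a ≡ 1 → b ≡ 0 → OneOf a b
  inRight : a ≡ 0 → b ≡ 1 → OneOf a b

oneOf : ∀ a b → a + b ≡ 1 → OneOf a b
oneOf zero          b       h  = inRight refl h
oneOf (suc zero)    zero    _  = inLeft refl refl
oneOf (suc zero)    (suc b) ()
oneOf (suc (suc a)) b       ()

subst-linear-⇒w : ∀ {s n n' m} {x : Fin n} {θ₀ θ₁ : Fin n → Obj tm n' m} → AgreeExcept x θ₀ θ₁ →
  θ₀ x ⇒w θ₁ x → (X : Obj s n m) → countV X x ≡ 1 → subst θ₀ X ⇒w subst θ₁ X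
subst-linear-⇒w {x = x} e w (var y) h rewrite eqCount≡1 y x h = w
subst-linear-⇒w e w (lam t) h = lamₛ (subst-linear-⇒w (agree-liftS e) (ren-⇒w suc id w) t h)
subst-linear-⇒w {x = x} e w (app t u) h with oneOf (countV t x) (countV u x) h
... | inLeft  ht hu rewrite subst-agree e u hu = appˡ (subst-linear-⇒w e w t ht)
... | inRight ht hu rewrite subst-agree e t ht = appʳ (subst-linear-⇒w e w u hu)
subst-linear-⇒w e w (mu c) h = muₛ (subst-linear-⇒w (agree-liftSN e) (ren-⇒w id suc w) c h)
subst-linear-⇒w {x = x} e w (es t u) h with oneOf (countV t (suc x)) (countV u x) h
... | inLeft  ht hu rewrite subst-agree e u hu = esˡ (subst-linear-⇒w (agree-liftS e) (ren-⇒w suc id w) t ht)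
... | inRight ht hu rewrite subst-agree (agree-liftS e) t ht = esʳ (subst-linear-⇒w e w u hu)
subst-linear-⇒w e w (named α t) h = namedₛ (subst-linear-⇒w e w t h)
subst-linear-⇒w {x = x} e w (rs c β u) h with oneOf (countV c x) (countV u x) h
... | inLeft  hc hu rewrite subst-agree e u hu = rsˡ (subst-linear-⇒w (agree-liftSN e) (ren-⇒w id suc w) c hc)
... | inRight hc hu rewrite subst-agree (agree-liftSN e) c hc = rsʳ (subst-linear-⇒w e w u hu)

-- Rep x v T T' : T' is T with ONE free occurrence of the variable x
-- replaced by v.  This is the context-free reading of the left-hand and
-- right-hand sides of the rules c_v and d_v: `TT[x]` versus `TT[u]`.
data Rep : ∀ {s n m} → Fin n → Obj tm n m → Obj s n m → Obj s n m → Set where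
  rvar   : ∀ {n m} {x : Fin n} {v : Obj tm n m} → Rep x v (var x) v
  rlam   : ∀ {n m} {x : Fin n} {v : Obj tm n m} {t t'} → Rep (suc x) (ren suc id v) t t' → Rep x v (lam t) (lam t')
  rappL  : ∀ {n m} {x : Fin n} {v : Obj tm n m} {t t' u} → Rep x v t t' → Rep x v (app t u) (app t' u)
  rappR  : ∀ {n m} {x : Fin n} {v : Obj tm n m} {t u u'} → Rep x v u u' → Rep x v (app t u) (app t u')
  rmu    : ∀ {n m} {x : Fin n} {v : Obj tm n m} {c c'} → Rep x (ren id suc v) c c' → Rep x v (mu c) (mu c')
  resL   : ∀ {n m} {x : Fin n} {v : Obj tm n m} {t t' u} → Rep (suc x) (ren suc id v) t t' → Rep x v (es t u) (es t' u)
  resR   : ∀ {n m} {x : Fin n} {v : Obj tm n m} {t u u'} → Rep x v u u' → Rep x v (es t u) (es t u')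
  rnamed : ∀ {n m} {x : Fin n} {v : Obj tm n m} {α t t'} → Rep x v t t' → Rep x v (named α t) (named α t')
  rrsL   : ∀ {n m} {x : Fin n} {v : Obj tm n m} {c c' β u} → Rep x (ren id suc v) c c' → Rep x v (rs c β u) (rs c' β u)
  rrsR   : ∀ {n m} {x : Fin n} {v : Obj tm n m} {c β u u'} → Rep x v u u' → Rep x v (rs c β u) (rs c β u')

plug-rep : ∀ {s n m n' m'} (C : Ctx s n m tm n' m') (x : Fin n) (v : Obj tm n m) →
  Rep x v (plug C (var (vEmb C x))) (plug C (ren (vEmb C) (nEmb C) v))
plug-rep hole x v = transport (Rep x v (var x)) (sym (ren-id-id v)) rvar
plug-rep (lamC C) x v =
  rlam (transport (Rep _ _ _) (cong (plug C) (ren-∘ _ _ _ _ v)) (plug-rep C (suc x) (ren suc id v)))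
plug-rep (appL C u) x v = rappL (plug-rep C x v)
plug-rep (appR t C) x v = rappR (plug-rep C x v)
plug-rep (muC C) x v =
  rmu (transport (Rep _ _ _) (cong (plug C) (ren-∘ _ _ _ _ v)) (plug-rep C x (ren id suc v)))
plug-rep (esL C u) x v =
  resL (transport (Rep _ _ _) (cong (plug C) (ren-∘ _ _ _ _ v)) (plug-rep C (suc x) (ren suc id v)))
plug-rep (esR t C) x v = resR (plug-rep C x v)
plug-rep (namedC α C) x v = rnamed (plug-rep C x v)
plug-rep (rsL C β u) x v =
  rrsL (transport (Rep _ _ _) (cong (plug C) (ren-∘ _ _ _ _ v)) (plug-rep C x (ren id suc v)))
plug-rep (rsR c β C) x v = rrsR (plug-rep C x v)

record RepInCtx {s n m} (x : Fin n) (v : Obj tm n m) (T T' : Obj s n m) : Set where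
  constructor repInCtx
  field
    {hn hm} : ℕ
    C       : Ctx s n m tm hn hm
    source  : T ≡ plug C (var (vEmb C x))
    target  : T' ≡ plug C (ren (vEmb C) (nEmb C) v)

rep-ctx : ∀ {s n m} {x : Fin n} {v : Obj tm n m} {T T' : Obj s n m} → Rep x v T T' → RepInCtx x v T T'
rep-ctx rvar = repInCtx hole refl (sym (ren-id-id _))
rep-ctx {v = v} (rlam r) with rep-ctx r
... | repInCtx C refl refl = repInCtx (lamC C) refl (cong (lam ∘ plug C) (ren-∘ _ _ _ _ v))
rep-ctx (rappL r) with rep-ctx r
... | repInCtx C refl refl = repInCtx (appL C _) refl refl
rep-ctx (rappR r) with rep-ctx r
... | repInCtx C refl refl = repInCtx (appR _ C) refl refl
rep-ctx {v = v} (rmu r) with rep-ctx r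
... | repInCtx C refl refl = repInCtx (muC C) refl (cong (mu ∘ plug C) (ren-∘ _ _ _ _ v))
rep-ctx {v = v} (resL r) with rep-ctx r
... | repInCtx C refl refl = repInCtx (esL C _) refl (cong (λ z → es (plug C z) _) (ren-∘ _ _ _ _ v))
rep-ctx (resR r) with rep-ctx r
... | repInCtx C refl refl = repInCtx (esR _ C) refl refl
rep-ctx (rnamed r) with rep-ctx r
... | repInCtx C refl refl = repInCtx (namedC _ C) refl refl
rep-ctx {v = v} (rrsL r) with rep-ctx r
... | repInCtx C refl refl = repInCtx (rsL C _ _) refl (cong (λ z → rs (plug C z) _ _) (ren-∘ _ _ _ _ v))
rep-ctx (rrsR r) with rep-ctx r
... | repInCtx C refl refl = repInCtx (rsR _ _ C) refl refl

ren-rep : ∀ {s n m N K} {x : Fin n} {v : Obj tm n m} {T T' : Obj s n m} → Rep x v T T' →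
  (ρ : Fin n → Fin N) (σ : Fin m → Fin K) → Rep (ρ x) (ren ρ σ v) (ren ρ σ T) (ren ρ σ T')
ren-rep rvar ρ σ = rvar
ren-rep {v = v} (rlam r) ρ σ =
  rlam (transport (λ z → Rep _ z _ _) (ren-square (λ _ → refl) (λ _ → refl) v) (ren-rep r (liftF ρ) σ))
ren-rep (rappL r) ρ σ = rappL (ren-rep r ρ σ)
ren-rep (rappR r) ρ σ = rappR (ren-rep r ρ σ)
ren-rep {v = v} (rmu r) ρ σ =
  rmu (transport (λ z → Rep _ z _ _) (ren-square (λ _ → refl) (λ _ → refl) v) (ren-rep r ρ (liftF σ)))
ren-rep {v = v} (resL r) ρ σ =
  resL (transport (λ z → Rep _ z _ _) (ren-square (λ _ → refl) (λ _ → refl) v) (ren-rep r (liftF ρ) σ))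
ren-rep (resR r) ρ σ = resR (ren-rep r ρ σ)
ren-rep (rnamed r) ρ σ = rnamed (ren-rep r ρ σ)
ren-rep {v = v} (rrsL r) ρ σ =
  rrsL (transport (λ z → Rep _ z _ _) (ren-square (λ _ → refl) (λ _ → refl) v) (ren-rep r ρ (liftF σ)))
ren-rep (rrsR r) ρ σ = rrsR (ren-rep r ρ σ)

rep-occurs : ∀ {s n m} {x : Fin n} {v : Obj tm n m} {T T' : Obj s n m} → Rep x v T T' → 1 ≤ countV T x
rep-occurs {x = x} rvar = ≤-reflexive (sym (eqCount-refl x))
rep-occurs (rlam r)   = rep-occurs r
rep-occurs (rappL r)  = ≤-trans (rep-occurs r) (m≤m+n _ _)
rep-occurs (rappR r)  = ≤-trans (rep-occurs r) (m≤n+m _ _)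
rep-occurs (rmu r)    = rep-occurs r
rep-occurs (resL r)   = ≤-trans (rep-occurs r) (m≤m+n _ _)
rep-occurs (resR r)   = ≤-trans (rep-occurs r) (m≤n+m _ _)
rep-occurs (rnamed r) = rep-occurs r
rep-occurs (rrsL r)   = ≤-trans (rep-occurs r) (m≤m+n _ _)
rep-occurs (rrsR r)   = ≤-trans (rep-occurs r) (m≤n+m _ _)

occurs-left : ∀ a b → a + b ≡ 1 → 1 ≤ a → a ≡ 1 × b ≡ 0
occurs-left (suc a) b h (s≤s _) with oneOf (suc a) b h
... | inLeft ha hb = ha , hb

occurs-right : ∀ a b → a + b ≡ 1 → 1 ≤ b → a ≡ 0 × b ≡ 1
occurs-right a (suc b) h (s≤s _) with oneOf a (suc b) h
... | inRight ha hb = ha , hb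

liftS-var : ∀ {n m} {θ : Fin n → Obj tm n m} → (∀ i → θ i ≡ var i) → ∀ i → liftS θ i ≡ var i
liftS-var e zero    = refl
liftS-var e (suc i) = cong (ren suc id) (e i)

subst-id : ∀ {s n m} {θ : Fin n → Obj tm n m} → (∀ i → θ i ≡ var i) → (X : Obj s n m) → subst θ X ≡ X
subst-id e (var x)     = e x
subst-id e (lam t)     = cong lam (subst-id (liftS-var e) t)
subst-id e (app t u)   = cong₂ app (subst-id e t) (subst-id e u)
subst-id e (mu c)      = cong mu (subst-id (λ i → cong (ren id suc) (e i)) c)
subst-id e (es t u)    = cong₂ es (subst-id (liftS-var e) t) (subst-id e u)
subst-id e (named α t) = cong (named α) (subst-id e t)
subst-id e (rs c β u)  = cong₂ (λ c' u' → rs c' β u') (subst-id (λ i → cong (ren id suc) (e i)) c) (subst-id e u)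

subst-id-off : ∀ {s n m} {x : Fin n} {θ : Fin n → Obj tm n m} → AgreeExcept x θ var →
  (X : Obj s n m) → countV X x ≡ 0 → subst θ X ≡ X
subst-id-off e X h = trans (subst-agree e X h) (subst-id (λ _ → refl) X)

agree-var-liftS : ∀ {n m} {x : Fin n} {θ : Fin n → Obj tm n m} →
  AgreeExcept x θ var → AgreeExcept (suc x) (liftS θ) var
agree-var-liftS e zero    _ = refl
agree-var-liftS e (suc y) h = cong (ren suc id) (e y h)

rep-as-subst : ∀ {s n m} {x : Fin n} {v : Obj tm n m} {T T' : Obj s n m} → Rep x v T T' →
  countV T x ≡ 1 → (θ : Fin n → Obj tm n m) → θ x ≡ v → AgreeExcept x θ var → T' ≡ subst θ T
rep-as-subst rvar h θ ex ag = sym ex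
rep-as-subst (rlam r) h θ ex ag =
  cong lam (rep-as-subst r h (liftS θ) (cong (ren suc id) ex) (agree-var-liftS ag))
rep-as-subst (rappL {u = u} r) h θ ex ag with occurs-left _ _ h (rep-occurs r)
... | ht , hu = cong₂ app (rep-as-subst r ht θ ex ag) (sym (subst-id-off ag u hu))
rep-as-subst (rappR {t = t} r) h θ ex ag with occurs-right _ _ h (rep-occurs r)
... | ht , hu = cong₂ app (sym (subst-id-off ag t ht)) (rep-as-subst r hu θ ex ag)
rep-as-subst (rmu r) h θ ex ag =
  cong mu (rep-as-subst r h (liftSN θ) (cong (ren id suc) ex) (agree-liftSN ag))
rep-as-subst (resL {u = u} r) h θ ex ag with occurs-left _ _ h (rep-occurs r)
... | ht , hu =
  cong₂ es (rep-as-subst r ht (liftS θ) (cong (ren suc id) ex) (agree-var-liftS ag)) (sym (subst-id-off ag u hu))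
rep-as-subst (resR {t = t} r) h θ ex ag with occurs-right _ _ h (rep-occurs r)
... | ht , hu = cong₂ es (sym (subst-id-off (agree-var-liftS ag) t ht)) (rep-as-subst r hu θ ex ag)
rep-as-subst (rnamed r) h θ ex ag = cong (named _) (rep-as-subst r h θ ex ag)
rep-as-subst (rrsL {u = u} r) h θ ex ag with occurs-left _ _ h (rep-occurs r)
... | hc , hu =
  cong₂ (λ c' u' → rs c' _ u') (rep-as-subst r hc (liftSN θ) (cong (ren id suc) ex) (agree-liftSN ag))
    (sym (subst-id-off ag u hu))
rep-as-subst (rrsR {c = c} r) h θ ex ag with occurs-right _ _ h (rep-occurs r)
... | hc , hu = cong₂ (λ c' u' → rs c' _ u') (sym (subst-id-off (agree-liftSN ag) c hc)) (rep-as-subst r hu θ ex ag)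

-- Consequently the c_v-reduct of a linear redex t[x/u] is the weakening of
-- its d_v-reduct: `TT[u]` equals the substitution t{x/u}, seen under the
-- (now vacuous) binder of x.
linear-rep-shape : ∀ {n m} (u : Obj tm n m) {T T' : Obj tm (suc n) m} → Rep zero (ren suc id u) T T' →
  countV T zero ≡ 1 → T' ≡ ren suc id (subst (single u) T)
linear-rep-shape u {T} r h = begin
  _                                ≡⟨ rep-as-subst r h θ refl ag ⟩
  subst θ T                        ≡⟨ cong (subst θ) (sym (ren-id-id T)) ⟩
  subst θ (ren id id T)            ≡⟨ sym (ren-subst {ρ₀ = id} (λ _ → refl) T) ⟩
  ren suc id (subst (single u) T)  ∎
  where
  open ≡-Reasoning
  θ : Fin _ → Obj tm _ _
  θ i = ren suc id (single u i)
  ag : AgreeExcept zero θ var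
  ag (suc y) _ = refl

rep-⇐w : ∀ {s n m} {X Y T' : Obj s n m} {x : Fin n} {v : Obj tm n m} → X ⇒w Y → Rep x v Y T' →
  ∃ λ T₀' → Rep x v X T₀' × (T₀' ⇒w T')
rep-⇐w {T' = T'} (root (wv t u)) r   = es (ren suc id T') u , resL (ren-rep r suc id) , root (wv T' u)
rep-⇐w {T' = T'} (root (wn c γ u)) r = rs (ren id suc T') γ u , rrsL (ren-rep r id suc) , root (wn T' γ u)
rep-⇐w (lamₛ w) (rlam r) with rep-⇐w w r
... | T , r' , w' = lam T , rlam r' , lamₛ w'
rep-⇐w (appˡ w) (rappL r) with rep-⇐w w r
... | T , r' , w' = app T _ , rappL r' , appˡ w'
rep-⇐w (appˡ {t = t} w) (rappR {u' = u'} r) = app t u' , rappR r , appˡ w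
rep-⇐w (appʳ w) (rappR r) with rep-⇐w w r
... | T , r' , w' = app _ T , rappR r' , appʳ w'
rep-⇐w (appʳ {u = u} w) (rappL {t' = t'} r) = app t' u , rappL r , appʳ w
rep-⇐w (muₛ w) (rmu r) with rep-⇐w w r
... | T , r' , w' = mu T , rmu r' , muₛ w'
rep-⇐w (esˡ w) (resL r) with rep-⇐w w r
... | T , r' , w' = es T _ , resL r' , esˡ w'
rep-⇐w (esˡ {t = t} w) (resR {u' = u'} r) = es t u' , resR r , esˡ w
rep-⇐w (esʳ w) (resR r) with rep-⇐w w r
... | T , r' , w' = es _ T , resR r' , esʳ w'
rep-⇐w (esʳ {u = u} w) (resL {t' = t'} r) = es t' u , resL r , esʳ w
rep-⇐w (namedₛ w) (rnamed r) with rep-⇐w w r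
... | T , r' , w' = named _ T , rnamed r' , namedₛ w'
rep-⇐w (rsˡ w) (rrsL r) with rep-⇐w w r
... | T , r' , w' = rs T _ _ , rrsL r' , rsˡ w'
rep-⇐w (rsˡ {c = c} w) (rrsR {u' = u'} r) = rs c _ u' , rrsR r , rsˡ w
rep-⇐w (rsʳ w) (rrsR r) with rep-⇐w w r
... | T , r' , w' = rs _ _ T , rrsR r' , rsʳ w'
rep-⇐w (rsʳ {u = u} w) (rrsL {c' = c'} r) = rs c' _ u , rrsL r , rsʳ w

cv-rep : ∀ {n m n' m'} (C : Ctx tm (suc n) m tm n' m') (u : Obj tm n m) →
  Rep zero (ren suc id u) (plug C (var (vEmb C zero))) (plug C (ren (vEmb C ∘ suc) (nEmb C) u))
cv-rep C u = transport (Rep _ _ _) (cong (plug C) (ren-∘ _ _ _ _ u)) (plug-rep C zero (ren suc id u))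

rep-cv : ∀ {n m} {u : Obj tm n m} {T T'} → Rep zero (ren suc id u) T T' →
  2 ≤ countV T zero → RootNE (es T u) (es T' u)
rep-cv {u = u} r h with rep-ctx r
... | repInCtx C refl refl =
  transport (λ z → RootNE (es (plug C (var (vEmb C zero))) u) (es (plug C z) u)) (sym (ren-∘ _ _ _ _ u)) (cv C u h)

rep-dv : ∀ {n m} {u : Obj tm n m} {T T'} → Rep zero (ren suc id u) T T' →
  countV T zero ≡ 1 → RootNE (es T u) (subst (single u) T)
rep-dv {u = u} r h with rep-ctx r
... | repInCtx C refl refl = dv C u h

-- RepN α β v T T' : T' is T with ONE command [α]t replaced by [β](t v).
-- This is the context-free reading of the two sides of c_n and d_n:
-- `CC[[α]t]` versus `CC[[γ]t u]`.
data RepN : ∀ {s n m} → Fin m → Fin m → Obj tm n m → Obj s n m → Obj s n m → Set where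
  nhere  : ∀ {n m} {α β : Fin m} {v : Obj tm n m} {t} → RepN α β v (named α t) (named β (app t v))
  nlam   : ∀ {n m} {α β : Fin m} {v : Obj tm n m} {t t'} → RepN α β (ren suc id v) t t' → RepN α β v (lam t) (lam t')
  nappL  : ∀ {n m} {α β : Fin m} {v : Obj tm n m} {t t' u} → RepN α β v t t' → RepN α β v (app t u) (app t' u)
  nappR  : ∀ {n m} {α β : Fin m} {v : Obj tm n m} {t u u'} → RepN α β v u u' → RepN α β v (app t u) (app t u')
  nmu    : ∀ {n m} {α β : Fin m} {v : Obj tm n m} {c c'} → RepN (suc α) (suc β) (ren id suc v) c c' → RepN α β v (mu c) (mu c')
  nesL   : ∀ {n m} {α β : Fin m} {v : Obj tm n m} {t t' u} → RepN α β (ren suc id v) t t' → RepN α β v (es t u) (es t' u)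
  nesR   : ∀ {n m} {α β : Fin m} {v : Obj tm n m} {t u u'} → RepN α β v u u' → RepN α β v (es t u) (es t u')
  nnamed : ∀ {n m} {α β : Fin m} {v : Obj tm n m} {γ t t'} → RepN α β v t t' → RepN α β v (named γ t) (named γ t')
  nrsL   : ∀ {n m} {α β : Fin m} {v : Obj tm n m} {c c' γ u} → RepN (suc α) (suc β) (ren id suc v) c c' → RepN α β v (rs c γ u) (rs c' γ u)
  nrsR   : ∀ {n m} {α β : Fin m} {v : Obj tm n m} {c γ u u'} → RepN α β v u u' → RepN α β v (rs c γ u) (rs c γ u')

plug-repN : ∀ {s n m n' m'} (C : Ctx s n m cm n' m') (α β : Fin m) (v : Obj tm n m) (t : Obj tm n' m') →
  RepN α β v (plug C (named (nEmb C α) t)) (plug C (named (nEmb C β) (app t (ren (vEmb C) (nEmb C) v))))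
plug-repN hole α β v t = transport (RepN α β v _) (cong (named β ∘ app t) (sym (ren-id-id v))) nhere
plug-repN (lamC C) α β v t =
  nlam (transport (RepN _ _ _ _) (cong (λ z → plug C (named _ (app t z))) (ren-∘ _ _ _ _ v)) (plug-repN C α β (ren suc id v) t))
plug-repN (appL C u) α β v t = nappL (plug-repN C α β v t)
plug-repN (appR s C) α β v t = nappR (plug-repN C α β v t)
plug-repN (muC C) α β v t =
  nmu (transport (RepN _ _ _ _) (cong (λ z → plug C (named _ (app t z))) (ren-∘ _ _ _ _ v)) (plug-repN C (suc α) (suc β) (ren id suc v) t))
plug-repN (esL C u) α β v t =
  nesL (transport (RepN _ _ _ _) (cong (λ z → plug C (named _ (app t z))) (ren-∘ _ _ _ _ v)) (plug-repN C α β (ren suc id v) t))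
plug-repN (esR s C) α β v t = nesR (plug-repN C α β v t)
plug-repN (namedC γ C) α β v t = nnamed (plug-repN C α β v t)
plug-repN (rsL C γ u) α β v t =
  nrsL (transport (RepN _ _ _ _) (cong (λ z → plug C (named _ (app t z))) (ren-∘ _ _ _ _ v)) (plug-repN C (suc α) (suc β) (ren id suc v) t))
plug-repN (rsR c γ C) α β v t = nrsR (plug-repN C α β v t)

record RepNInCtx {s n m} (α β : Fin m) (v : Obj tm n m) (T T' : Obj s n m) : Set where
  constructor repNInCtx
  field
    {hn hm} : ℕ
    C       : Ctx s n m cm hn hm
    t       : Obj tm hn hm
    source  : T ≡ plug C (named (nEmb C α) t)
    target  : T' ≡ plug C (named (nEmb C β) (app t (ren (vEmb C) (nEmb C) v)))

repN-ctx : ∀ {s n m} {α β : Fin m} {v : Obj tm n m} {T T' : Obj s n m} → RepN α β v T T' → RepNInCtx α β v T T'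
repN-ctx {v = v} (nhere {t = t}) = repNInCtx hole t refl (cong (named _ ∘ app t) (sym (ren-id-id v)))
repN-ctx {v = v} (nlam r) with repN-ctx r
... | repNInCtx C t refl refl =
  repNInCtx (lamC C) t refl (cong (λ z → lam (plug C (named _ (app t z)))) (ren-∘ _ _ _ _ v))
repN-ctx (nappL r) with repN-ctx r
... | repNInCtx C t refl refl = repNInCtx (appL C _) t refl refl
repN-ctx (nappR r) with repN-ctx r
... | repNInCtx C t refl refl = repNInCtx (appR _ C) t refl refl
repN-ctx {v = v} (nmu r) with repN-ctx r
... | repNInCtx C t refl refl =
  repNInCtx (muC C) t refl (cong (λ z → mu (plug C (named _ (app t z)))) (ren-∘ _ _ _ _ v))
repN-ctx {v = v} (nesL r) with repN-ctx r
... | repNInCtx C t refl refl =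
  repNInCtx (esL C _) t refl (cong (λ z → es (plug C (named _ (app t z))) _) (ren-∘ _ _ _ _ v))
repN-ctx (nesR r) with repN-ctx r
... | repNInCtx C t refl refl = repNInCtx (esR _ C) t refl refl
repN-ctx (nnamed r) with repN-ctx r
... | repNInCtx C t refl refl = repNInCtx (namedC _ C) t refl refl
repN-ctx {v = v} (nrsL r) with repN-ctx r
... | repNInCtx C t refl refl =
  repNInCtx (rsL C _ _) t refl (cong (λ z → rs (plug C (named _ (app t z))) _ _) (ren-∘ _ _ _ _ v))
repN-ctx (nrsR r) with repN-ctx r
... | repNInCtx C t refl refl = repNInCtx (rsR _ _ C) t refl refl

ren-repN : ∀ {s n m N K} {α β : Fin m} {v : Obj tm n m} {T T' : Obj s n m} → RepN α β v T T' →
  (ρ : Fin n → Fin N) (σ : Fin m → Fin K) → RepN (σ α) (σ β) (ren ρ σ v) (ren ρ σ T) (ren ρ σ T')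
ren-repN nhere ρ σ = nhere
ren-repN {v = v} (nlam r) ρ σ =
  nlam (transport (λ z → RepN _ _ z _ _) (ren-square (λ _ → refl) (λ _ → refl) v) (ren-repN r (liftF ρ) σ))
ren-repN (nappL r) ρ σ = nappL (ren-repN r ρ σ)
ren-repN (nappR r) ρ σ = nappR (ren-repN r ρ σ)
ren-repN {v = v} (nmu r) ρ σ =
  nmu (transport (λ z → RepN _ _ z _ _) (ren-square (λ _ → refl) (λ _ → refl) v) (ren-repN r ρ (liftF σ)))
ren-repN {v = v} (nesL r) ρ σ =
  nesL (transport (λ z → RepN _ _ z _ _) (ren-square (λ _ → refl) (λ _ → refl) v) (ren-repN r (liftF ρ) σ))
ren-repN (nesR r) ρ σ = nesR (ren-repN r ρ σ)
ren-repN (nnamed r) ρ σ = nnamed (ren-repN r ρ σ)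
ren-repN {v = v} (nrsL r) ρ σ =
  nrsL (transport (λ z → RepN _ _ z _ _) (ren-square (λ _ → refl) (λ _ → refl) v) (ren-repN r ρ (liftF σ)))
ren-repN (nrsR r) ρ σ = nrsR (ren-repN r ρ σ)

repN-⇐w : ∀ {s n m} {X Y T' : Obj s n m} {α β : Fin m} {v : Obj tm n m} → X ⇒w Y → RepN α β v Y T' →
  ∃ λ T₀' → RepN α β v X T₀' × (T₀' ⇒w T')
repN-⇐w {T' = T'} (root (wv t u)) r   = es (ren suc id T') u , nesL (ren-repN r suc id) , root (wv T' u)
repN-⇐w {T' = T'} (root (wn c γ u)) r = rs (ren id suc T') γ u , nrsL (ren-repN r id suc) , root (wn T' γ u)
repN-⇐w (lamₛ w) (nlam r) with repN-⇐w w r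
... | T , r' , w' = lam T , nlam r' , lamₛ w'
repN-⇐w (appˡ w) (nappL r) with repN-⇐w w r
... | T , r' , w' = app T _ , nappL r' , appˡ w'
repN-⇐w (appˡ {t = t} w) (nappR {u' = u'} r) = app t u' , nappR r , appˡ w
repN-⇐w (appʳ w) (nappR r) with repN-⇐w w r
... | T , r' , w' = app _ T , nappR r' , appʳ w'
repN-⇐w (appʳ {u = u} w) (nappL {t' = t'} r) = app t' u , nappL r , appʳ w
repN-⇐w (muₛ w) (nmu r) with repN-⇐w w r
... | T , r' , w' = mu T , nmu r' , muₛ w'
repN-⇐w (esˡ w) (nesL r) with repN-⇐w w r
... | T , r' , w' = es T _ , nesL r' , esˡ w'
repN-⇐w (esˡ {t = t} w) (nesR {u' = u'} r) = es t u' , nesR r , esˡ w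
repN-⇐w (esʳ w) (nesR r) with repN-⇐w w r
... | T , r' , w' = es _ T , nesR r' , esʳ w'
repN-⇐w (esʳ {u = u} w) (nesL {t' = t'} r) = es t' u , nesL r , esʳ w
repN-⇐w (namedₛ w) (nnamed r) with repN-⇐w w r
... | T , r' , w' = named _ T , nnamed r' , namedₛ w'
repN-⇐w (namedₛ {t = t} w) (nhere {β = β} {v = v}) = named β (app t v) , nhere , namedₛ (appˡ w)
repN-⇐w (rsˡ w) (nrsL r) with repN-⇐w w r
... | T , r' , w' = rs T _ _ , nrsL r' , rsˡ w'
repN-⇐w (rsˡ {c = c} w) (nrsR {u' = u'} r) = rs c _ u' , nrsR r , rsˡ w
repN-⇐w (rsʳ w) (nrsR r) with repN-⇐w w r
... | T , r' , w' = rs _ _ T , nrsR r' , rsʳ w'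
repN-⇐w (rsʳ {u = u} w) (nrsL {c' = c'} r) = rs c' _ u , nrsL r , rsʳ w

repN-count : ∀ {s n m} {α β : Fin m} {v : Obj tm n m} {T T' : Obj s n m} → RepN α β v T T' →
  eqCount β α ≡ 0 → countN v α ≡ 0 → suc (countN T' α) ≡ countN T α
repN-count {α = α} (nhere {t = t}) hβ hv
  rewrite hβ | hv | eqCount-refl α | +-identityʳ (countN t α) = refl
repN-count (nlam {v = v} r) hβ hv = repN-count r hβ (trans (countN-ren (λ _ → refl) v) hv)
repN-count (nappL {u = u} r) hβ hv = cong (_+ countN u _) (repN-count r hβ hv)
repN-count (nappR {t = t} {u' = u'} r) hβ hv =
  trans (sym (+-suc (countN t _) (countN u' _))) (cong (countN t _ +_) (repN-count r hβ hv))
repN-count (nmu {v = v} r) hβ hv = repN-count r hβ (trans (countN-ren (λ _ → refl) v) hv)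
repN-count (nesL {v = v} {u = u} r) hβ hv =
  cong (_+ countN u _) (repN-count r hβ (trans (countN-ren (λ _ → refl) v) hv))
repN-count (nesR {t = t} {u' = u'} r) hβ hv =
  trans (sym (+-suc (countN t _) (countN u' _))) (cong (countN t _ +_) (repN-count r hβ hv))
repN-count {α = α} (nnamed {γ = γ} {t' = t'} r) hβ hv =
  trans (sym (+-suc (eqCount γ α) (countN t' _))) (cong (eqCount γ α +_) (repN-count r hβ hv))
repN-count {α = α} (nrsL {v = v} {γ = γ} {u = u} r) hβ hv =
  cong (λ k → k + eqCount γ α + countN u α) (repN-count r hβ (trans (countN-ren (λ _ → refl) v) hv))
repN-count {α = α} (nrsR {c = c} {γ = γ} {u' = u'} r) hβ hv =
  trans (sym (+-suc (countN c (suc α) + eqCount γ α) (countN u' _)))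
        (cong (countN c (suc α) + eqCount γ α +_) (repN-count r hβ hv))

rs-cong : ∀ {n m} {c c' : Obj cm n (suc m)} {β β' : Fin m} {u u' : Obj tm n m} →
  c ≡ c' → β ≡ β' → u ≡ u' → rs c β u ≡ rs c' β' u'
rs-cong refl refl refl = refl

liftF-off : ∀ {m} {σ : Fin m → Fin m} {α : Fin m} → (∀ j → eqCount j α ≡ 0 → σ j ≡ j) →
  ∀ j → eqCount j (suc α) ≡ 0 → liftF σ j ≡ j
liftF-off f zero    _ = refl
liftF-off f (suc j) p = cong suc (f j p)

ren-id-off : ∀ {s n m} {ρ : Fin n → Fin n} {σ : Fin m → Fin m} {α : Fin m} → (∀ i → ρ i ≡ i) →
  (∀ j → eqCount j α ≡ 0 → σ j ≡ j) → (X : Obj s n m) → countN X α ≡ 0 → ren ρ σ X ≡ X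
ren-id-off e f (var x) h = cong var (e x)
ren-id-off e f (lam t) h = cong lam (ren-id-off (liftF-id e) f t h)
ren-id-off e f (app t u) h = cong₂ app (ren-id-off e f t (m+n≡0⇒m≡0 _ h)) (ren-id-off e f u (m+n≡0⇒n≡0 _ h))
ren-id-off e f (mu c) h = cong mu (ren-id-off e (liftF-off f) c h)
ren-id-off e f (es t u) h =
  cong₂ es (ren-id-off (liftF-id e) f t (m+n≡0⇒m≡0 _ h)) (ren-id-off e f u (m+n≡0⇒n≡0 _ h))
ren-id-off e f (named β t) h = cong₂ named (f β (m+n≡0⇒m≡0 _ h)) (ren-id-off e f t (m+n≡0⇒n≡0 _ h))
ren-id-off {α = α} e f (rs c β u) h =
  rs-cong (ren-id-off e (liftF-off f) c (m+n≡0⇒m≡0 (countN c (suc α)) hcβ))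
          (f β (m+n≡0⇒n≡0 (countN c (suc α)) hcβ))
          (ren-id-off e f u (m+n≡0⇒n≡0 (countN c (suc α) + eqCount β α) h))
  where hcβ = m+n≡0⇒m≡0 (countN c (suc α) + eqCount β α) h

-- After replacing the only occurrence of the bound name, that name is
-- unused: the d_n-reduct is the w_n-reduct of the c_n-reduct.
linear-repN-erase : ∀ {n m} (γ : Fin m) (u : Obj tm n m) {c c' : Obj cm n (suc m)} →
  RepN zero (suc γ) (ren id suc u) c c' → countN c zero ≡ 1 → rs c' γ u ⇒w ren id (singleN γ) c'
linear-repN-erase γ u {c' = c'} r h =
  root (transport (λ z → RootW (rs z γ u) (ren id (singleN γ) c')) restore (wn (ren id (singleN γ) c') γ u))
  where
  unused : countN c' zero ≡ 0
  unused = suc-injective (trans (repN-count r refl (countN-ren-fresh (λ _ → refl) u)) h)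
  off-zero : ∀ j → eqCount j zero ≡ 0 → suc (singleN γ j) ≡ j
  off-zero (suc j) _ = refl
  restore : ren id suc (ren id (singleN γ) c') ≡ c'
  restore = trans (ren-∘ _ _ _ _ c') (ren-id-off (λ _ → refl) off-zero c' unused)

cn-repN : ∀ {n m n' m'} (C : Ctx cm n (suc m) cm n' m') (t : Obj tm n' m') (γ : Fin m) (u : Obj tm n m) →
  RepN zero (suc γ) (ren id suc u) (plug C (named (nEmb C zero) t))
       (plug C (named (nEmb C (suc γ)) (app t (ren (vEmb C) (nEmb C ∘ suc) u))))
cn-repN C t γ u =
  transport (RepN _ _ _ _) (cong (λ z → plug C (named _ (app t z))) (ren-∘ _ _ _ _ u)) (plug-repN C zero (suc γ) (ren id suc u) t)

repN-cn : ∀ {n m} {γ : Fin m} {u : Obj tm n m} {c c'} → RepN zero (suc γ) (ren id suc u) c c' →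
  2 ≤ countN c zero → RootNE (rs c γ u) (rs c' γ u)
repN-cn {γ = γ} {u} r h with repN-ctx r
... | repNInCtx C t refl refl =
  transport (λ z → RootNE (rs (plug C (named (nEmb C zero) t)) γ u) (rs (plug C (named _ (app t z))) γ u))
    (sym (ren-∘ _ _ _ _ u)) (cn C t γ u h)

repN-dn : ∀ {n m} {γ : Fin m} {u : Obj tm n m} {c c'} → RepN zero (suc γ) (ren id suc u) c c' →
  countN c zero ≡ 1 → RootNE (rs c γ u) (ren id (singleN γ) c')
repN-dn {γ = γ} {u} r h with repN-ctx r
... | repNInCtx C t refl refl =
  transport (λ z → RootNE (rs (plug C (named (nEmb C zero) t)) γ u) (ren id (singleN γ) (plug C (named _ (app t z)))))
    (sym (ren-∘ _ _ _ _ u)) (dn C t γ u h)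

scopeL : ∀ {n n' m} → LCtx n n' m → ℕ → ℕ
scopeL □L        N = N
scopeL (L [ u ]) N = scopeL L (suc N)

renL : ∀ {n n' m N K} (L : LCtx n n' m) → (Fin n → Fin N) → (Fin m → Fin K) → LCtx N (scopeL L N) K
renL □L        ρ σ = □L
renL (L [ u ]) ρ σ = renL L (liftF ρ) σ [ ren ρ σ u ]

holeRenL : ∀ {n n' m N} (L : LCtx n n' m) → (Fin n → Fin N) → Fin n' → Fin (scopeL L N)
holeRenL □L        ρ = ρ
holeRenL (L [ u ]) ρ = holeRenL L (liftF ρ)

ren-plugL : ∀ {n n' m N K} (L : LCtx n n' m) (ρ : Fin n → Fin N) (σ : Fin m → Fin K) X →
  ren ρ σ (plugL L X) ≡ plugL (renL L ρ σ) (ren (holeRenL L ρ) σ X)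
ren-plugL □L        ρ σ X = refl
ren-plugL (L [ u ]) ρ σ X = cong (λ z → es z _) (ren-plugL L _ σ X)

wkL-ren : ∀ {n n' m N K} (L : LCtx n n' m) (ρ : Fin n → Fin N) (σ : Fin m → Fin K) i →
  wkL (renL L ρ σ) (ρ i) ≡ holeRenL L ρ (wkL L i)
wkL-ren □L        ρ σ i = refl
wkL-ren (L [ u ]) ρ σ i = wkL-ren L _ σ (suc i)

reductB : ∀ {n n₁ m} → LCtx n n₁ m → Obj tm (suc n₁) m → Obj tm n m → Obj tm n m
reductB L t u = plugL L (es t (ren (wkL L) id u))

reductM : ∀ {n n₁ m} → LCtx n n₁ m → Obj cm n₁ (suc m) → Obj tm n m → Obj tm n m
reductM L c u = plugL L (mu (rs (ren id (liftF suc) c) zero (ren (wkL L) suc u)))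

liftF-liftF-suc : ∀ {m K} (σ : Fin m → Fin K) j → liftF (liftF σ) (liftF suc j) ≡ liftF suc (liftF σ j)
liftF-liftF-suc σ zero    = refl
liftF-liftF-suc σ (suc j) = refl

singleN-ren : ∀ {m K} (σ : Fin m → Fin K) (γ : Fin m) j → σ (singleN γ j) ≡ singleN (σ γ) (liftF σ j)
singleN-ren σ γ zero    = refl
singleN-ren σ γ (suc j) = refl

renamed-cv-rep : ∀ {n m N K n' m'} (ρ : Fin n → Fin N) (σ : Fin m → Fin K)
  (C : Ctx tm (suc n) m tm n' m') (u : Obj tm n m) →
  Rep zero (ren suc id (ren ρ σ u)) (ren (liftF ρ) σ (plug C (var (vEmb C zero))))
      (ren (liftF ρ) σ (plug C (ren (vEmb C ∘ suc) (nEmb C) u)))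
renamed-cv-rep ρ σ C u =
  transport (λ z → Rep zero z (ren (liftF ρ) σ T) (ren (liftF ρ) σ T'))
    (ren-square (λ _ → refl) (λ _ → refl) u) (ren-rep (cv-rep C u) (liftF ρ) σ)
  where
  T  = plug C (var (vEmb C zero))
  T' = plug C (ren (vEmb C ∘ suc) (nEmb C) u)

renamed-cn-repN : ∀ {n m N K n' m'} (ρ : Fin n → Fin N) (σ : Fin m → Fin K)
  (C : Ctx cm n (suc m) cm n' m') (t : Obj tm n' m') (γ : Fin m) (u : Obj tm n m) →
  RepN zero (suc (σ γ)) (ren id suc (ren ρ σ u)) (ren ρ (liftF σ) (plug C (named (nEmb C zero) t)))
       (ren ρ (liftF σ) (plug C (named (nEmb C (suc γ)) (app t (ren (vEmb C) (nEmb C ∘ suc) u)))))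
renamed-cn-repN ρ σ C t γ u =
  transport (λ z → RepN zero (suc (σ γ)) z (ren ρ (liftF σ) c) (ren ρ (liftF σ) c'))
    (ren-square (λ _ → refl) (λ _ → refl) u) (ren-repN (cn-repN C t γ u) ρ (liftF σ))
  where
  c  = plug C (named (nEmb C zero) t)
  c' = plug C (named (nEmb C (suc γ)) (app t (ren (vEmb C) (nEmb C ∘ suc) u)))

-- Non-erasing root steps are stable under renaming.  For the rules with a
-- context (c_v, d_v, c_n, d_n) this goes through their description by
-- replacements, which commute with renaming.
ren-rootNE : RenStable RootNE
ren-rootNE ρ σ (B L t u) =
  subst₂ RootNE (sym (cong (λ z → app z (ren ρ σ u)) (ren-plugL L ρ σ (lam t))))
    (sym (trans (ren-plugL L ρ σ _)
      (cong (λ z → plugL (renL L ρ σ) (es (ren (liftF (holeRenL L ρ)) σ t) z))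
            (ren-square (λ i → sym (wkL-ren L ρ σ i)) (λ _ → refl) u))))
    (B (renL L ρ σ) _ (ren ρ σ u))
ren-rootNE ρ σ (M L c u) =
  subst₂ RootNE (sym (cong (λ z → app z (ren ρ σ u)) (ren-plugL L ρ σ (mu c))))
    (sym (trans (ren-plugL L ρ σ _)
      (cong (λ z → plugL (renL L ρ σ) (mu z))
        (cong₂ (λ c' u' → rs c' zero u') (ren-square (λ _ → refl) (liftF-liftF-suc σ) c)
               (ren-square (λ i → sym (wkL-ren L ρ σ i)) (λ _ → refl) u)))))
    (M (renL L ρ σ) _ (ren ρ σ u))
ren-rootNE ρ σ (cv C u h) =
  rep-cv (renamed-cv-rep ρ σ C u)
    (transport (2 ≤_) (sym (countV-ren (liftF-eqCount-zero ρ) (plug C (var (vEmb C zero))))) h)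
ren-rootNE ρ σ (dv C u h) =
  transport (RootNE _) (sym (ren-subst (single-ren ρ σ u) (plug C (var (vEmb C zero)))))
    (rep-dv (renamed-cv-rep ρ σ C u) (trans (countV-ren (liftF-eqCount-zero ρ) (plug C (var (vEmb C zero)))) h))
  where
  single-ren : ∀ {n N m K} (ρ : Fin n → Fin N) (σ : Fin m → Fin K) (u : Obj tm n m) i →
    ren ρ σ (single u i) ≡ single (ren ρ σ u) (liftF ρ i)
  single-ren ρ σ u zero    = refl
  single-ren ρ σ u (suc i) = refl
ren-rootNE ρ σ (cn C t γ u h) =
  repN-cn (renamed-cn-repN ρ σ C t γ u)
    (transport (2 ≤_) (sym (countN-ren (liftF-eqCount-zero σ) (plug C (named (nEmb C zero) t)))) h)
ren-rootNE ρ σ (dn C t γ u h) =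
  transport (RootNE _) (ren-square (λ _ → refl) (λ j → sym (singleN-ren σ γ j)) _)
    (repN-dn (renamed-cn-repN ρ σ C t γ u)
      (trans (countN-ren (liftF-eqCount-zero σ) (plug C (named (nEmb C zero) t))) h))

ren-⇒ne : RenStable _⇒ne_
ren-⇒ne = ren-step ren-rootNE

-- A w-step into the head L[λx.t] of a B-redex comes from a head of the
-- same shape L₀[λx.t₀], and the w-step survives firing B.
record HeadB {n m n₁} (X : Obj tm n m) (L : LCtx n n₁ m) (t : Obj tm (suc n₁) m) : Set where
  constructor headB
  field
    {n₀}  : ℕ
    L₀    : LCtx n n₀ m
    t₀    : Obj tm (suc n₀) m
    shape : X ≡ plugL L₀ (lam t₀)
    after : ∀ u → reductB L₀ t₀ u ⇒w reductB L t u

headB-⇐w : ∀ {n m n₁} {X : Obj tm n m} (L : LCtx n n₁ m) (t : Obj tm (suc n₁) m) →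
  X ⇒w plugL L (lam t) → HeadB X L t
headB-⇐w □L t (lamₛ {t = t₀} w) = headB □L t₀ refl (λ u → esˡ w)
headB-⇐w (L [ v ]) t (esˡ w) with headB-⇐w L t w
... | headB L₀ t₀ refl after = headB (L₀ [ v ]) t₀ refl (λ u → esˡ (under-binder u))
  where
  under-binder : ∀ u → plugL L₀ (es t₀ (ren (wkL L₀ ∘ suc) id u)) ⇒w plugL L (es t (ren (wkL L ∘ suc) id u))
  under-binder u = subst₂ _⇒w_ (cong (λ z → plugL L₀ (es t₀ z)) (ren-∘ _ _ _ _ u))
                               (cong (λ z → plugL L (es t z)) (ren-∘ _ _ _ _ u)) (after (ren suc id u))
headB-⇐w (L [ v ]) t (esʳ {u = v₀} w) = headB (L [ v₀ ]) t refl (λ u → esʳ w)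
headB-⇐w L t (root (wv _ v)) =
  headB (renL L suc id [ v ]) t₀ (cong (λ z → es z v) (ren-plugL L suc id (lam t))) after
  where
  t₀ = ren (liftF (holeRenL L suc)) id t
  after : ∀ u → reductB (renL L suc id [ v ]) t₀ u ⇒w reductB L t u
  after u = root (transport (λ z → RootW (es z v) (reductB L t u))
    (trans (ren-plugL L suc id _)
           (cong (λ z → plugL (renL L suc id) (es t₀ z)) (ren-fusion (λ i → sym (wkL-ren L suc id i)) (λ _ → refl) u)))
    (wv (reductB L t u) v))

-- Likewise for the head L[μα.c] of an M-redex.
record HeadM {n m n₁} (X : Obj tm n m) (L : LCtx n n₁ m) (c : Obj cm n₁ (suc m)) : Set where
  constructor headM
  field
    {n₀}  : ℕ
    L₀    : LCtx n n₀ m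
    c₀    : Obj cm n₀ (suc m)
    shape : X ≡ plugL L₀ (mu c₀)
    after : ∀ u → reductM L₀ c₀ u ⇒w reductM L c u

headM-⇐w : ∀ {n m n₁} {X : Obj tm n m} (L : LCtx n n₁ m) (c : Obj cm n₁ (suc m)) →
  X ⇒w plugL L (mu c) → HeadM X L c
headM-⇐w □L c (muₛ {c = c₀} w) = headM □L c₀ refl (λ u → muₛ (rsˡ (ren-⇒w id (liftF suc) w)))
headM-⇐w (L [ v ]) c (esˡ w) with headM-⇐w L c w
... | headM L₀ c₀ refl after = headM (L₀ [ v ]) c₀ refl (λ u → esˡ (under-binder u))
  where
  under-binder : ∀ u → plugL L₀ (mu (rs (ren id (liftF suc) c₀) zero (ren (wkL L₀ ∘ suc) suc u))) ⇒w
                       plugL L (mu (rs (ren id (liftF suc) c) zero (ren (wkL L ∘ suc) suc u)))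
  under-binder u = subst₂ _⇒w_ (cong (λ z → plugL L₀ (mu (rs _ zero z))) (ren-∘ _ _ _ _ u))
                               (cong (λ z → plugL L (mu (rs _ zero z))) (ren-∘ _ _ _ _ u)) (after (ren suc id u))
headM-⇐w (L [ v ]) c (esʳ {u = v₀} w) = headM (L [ v₀ ]) c refl (λ u → esʳ w)
headM-⇐w L c (root (wv _ v)) =
  headM (renL L suc id [ v ]) c₀ (cong (λ z → es z v) (ren-plugL L suc id (mu c))) after
  where
  c₀ = ren (holeRenL L suc) (liftF id) c
  after : ∀ u → reductM (renL L suc id [ v ]) c₀ u ⇒w reductM L c u
  after u = root (transport (λ z → RootW (es z v) (reductM L c u))
    (trans (ren-plugL L suc id _)
      (cong (λ z → plugL (renL L suc id) (mu z))
        (cong₂ (λ c' u' → rs c' zero u') (ren-square (λ _ → refl) (liftF-liftF-suc id) c)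
               (ren-fusion (λ i → sym (wkL-ren L suc id i)) (λ _ → refl) u))))
    (wv (reductM L c u) v))

NeThenW : ∀ {s n m} → Obj s n m → Obj s n m → Set
NeThenW o o' = ∃ λ o₂ → (o ⇒ne o₂) × (o₂ ⇒w⁺ o')

plug-⇒w⁺ : ∀ {s n m s' n' m'} (C : Ctx s n m s' n' m') {X Y} → X ⇒w⁺ Y → plug C X ⇒w⁺ plug C Y
plug-⇒w⁺ C [ w ]⁺    = [ plug-step C w ]⁺
plug-⇒w⁺ C (w ∷ ws) = plug-step C w ∷ plug-⇒w⁺ C ws

plug-NeThenW : ∀ {s n m s' n' m'} (C : Ctx s n m s' n' m') {X Y} → NeThenW X Y → NeThenW (plug C X) (plug C Y)
plug-NeThenW C (o₂ , ne , ws) = plug C o₂ , plug-step C ne , plug-⇒w⁺ C ws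

-- An erasing root step followed by a step inside the kept part: perform
-- the step first, under the substitution / replacement to be erased.
swap-w-root : ∀ {s n m} {X Y Z : Obj s n m} → RootW X Y → Y ⇒ne Z → NeThenW X Z
swap-w-root {Z = Z} (wv t u) ne   = es (ren suc id Z) u , esˡ (ren-⇒ne suc id ne) , [ root (wv Z u) ]⁺
swap-w-root {Z = Z} (wn c γ u) ne = rs (ren id suc Z) γ u , rsˡ (ren-⇒ne id suc ne) , [ root (wn Z γ u) ]⁺

-- B and M: a w-step in the head keeps the redex (headB-⇐w, headM-⇐w); a
-- w-step in the argument is performed inside the reduct.
swap-B-head : ∀ {n n₁ m} {X : Obj tm n m} (L : LCtx n n₁ m) t u →
  X ⇒w plugL L (lam t) → NeThenW (app X u) (reductB L t u)
swap-B-head L t u w with headB-⇐w L t w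
... | headB L₀ t₀ refl after = reductB L₀ t₀ u , root (B L₀ t₀ u) , [ after u ]⁺

swap-B-arg : ∀ {n n₁ m} (L : LCtx n n₁ m) t {u₀ u : Obj tm n m} →
  u₀ ⇒w u → NeThenW (app (plugL L (lam t)) u₀) (reductB L t u)
swap-B-arg L t w = _ , root (B L t _) , [ plugL-step L (esʳ (ren-⇒w (wkL L) id w)) ]⁺

swap-M-head : ∀ {n n₁ m} {X : Obj tm n m} (L : LCtx n n₁ m) c u →
  X ⇒w plugL L (mu c) → NeThenW (app X u) (reductM L c u)
swap-M-head L c u w with headM-⇐w L c w
... | headM L₀ c₀ refl after = reductM L₀ c₀ u , root (M L₀ c₀ u) , [ after u ]⁺

swap-M-arg : ∀ {n n₁ m} (L : LCtx n n₁ m) c {u₀ u : Obj tm n m} →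
  u₀ ⇒w u → NeThenW (app (plugL L (mu c)) u₀) (reductM L c u)
swap-M-arg L c w = _ , root (M L c _) , [ plugL-step L (muₛ (rsʳ (ren-⇒w (wkL L) suc w))) ]⁺

-- The replaced occurrence is
-- carried back along the w-step (rep-⇐w), and counts only drop along w, so
-- the source of a c_v-redex is again a c_v-redex.  The source of a d_v-redex
-- is either linear (fire d_v, then the w-step under the substitution) or
-- has erased copies of x (fire c_v; once the w-step has removed them, a
-- w_v-step drops the now unused substitution).
swap-cv-body : ∀ {n m} {u : Obj tm n m} {X T T'} → X ⇒w T → Rep zero (ren suc id u) T T' →
  2 ≤ countV T zero → NeThenW (es X u) (es T' u)
swap-cv-body {u = u} w r h with rep-⇐w w r
... | T₀' , r₀ , w₀ = es T₀' u , root (rep-cv r₀ (≤-trans h (countV-⇒w w zero))) , [ esˡ w₀ ]⁺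

swap-dv-body : ∀ {n m} {u : Obj tm n m} {X T T'} → X ⇒w T → Rep zero (ren suc id u) T T' →
  countV T zero ≡ 1 → NeThenW (es X u) (subst (single u) T)
swap-dv-body {u = u} {X} {T} w r h with rep-⇐w w r
... | T₀' , r₀ , w₀ with m≤n⇒m<n∨m≡n (transport (_≤ countV X zero) h (countV-⇒w w zero))
... | inj₂ linear = subst (single u) X , root (rep-dv r₀ (sym linear)) , [ subst-⇒w (single u) w ]⁺
... | inj₁ shared =
  es T₀' u , root (rep-cv r₀ shared) ,
  esˡ w₀ ∷ [ root (transport (λ z → RootW (es z u) _) (sym (linear-rep-shape u r h)) (wv (subst (single u) T) u)) ]⁺

-- c_v / d_v with the w-step in the substituted term: fire the rule first,
-- then perform the w-step in every copy (c_v: two copies; d_v: the single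
-- copy, by linearity of the substitution).
swap-cv-arg : ∀ {n m n' m'} (C : Ctx tm (suc n) m tm n' m') {u₀ u : Obj tm n m} →
  2 ≤ countV (plug C (var (vEmb C zero))) zero → u₀ ⇒w u →
  NeThenW (es (plug C (var (vEmb C zero))) u₀) (es (plug C (ren (vEmb C ∘ suc) (nEmb C) u)) u)
swap-cv-arg C h w = _ , root (cv C _ h) , esˡ (plug-step C (ren-⇒w _ _ w)) ∷ [ esʳ w ]⁺

swap-dv-arg : ∀ {n m n' m'} (C : Ctx tm (suc n) m tm n' m') {u₀ u : Obj tm n m} →
  countV (plug C (var (vEmb C zero))) zero ≡ 1 → u₀ ⇒w u →
  NeThenW (es (plug C (var (vEmb C zero))) u₀) (subst (single u) (plug C (var (vEmb C zero))))
swap-dv-arg C {u₀} {u} h w =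
  _ , root (dv C _ h) , [ subst-linear-⇒w single-agree w (plug C (var (vEmb C zero))) h ]⁺
  where
  single-agree : AgreeExcept zero (single u₀) (single u)
  single-agree (suc y) _ = refl

swap-cn-body : ∀ {n m} {γ : Fin m} {u : Obj tm n m} {X c c'} → X ⇒w c → RepN zero (suc γ) (ren id suc u) c c' →
  2 ≤ countN c zero → NeThenW (rs X γ u) (rs c' γ u)
swap-cn-body {γ = γ} {u} w r h with repN-⇐w w r
... | c₀' , r₀ , w₀ = rs c₀' γ u , root (repN-cn r₀ (≤-trans h (countN-⇒w w zero))) , [ rsˡ w₀ ]⁺

swap-dn-body : ∀ {n m} {γ : Fin m} {u : Obj tm n m} {X c c'} → X ⇒w c → RepN zero (suc γ) (ren id suc u) c c' →
  countN c zero ≡ 1 → NeThenW (rs X γ u) (ren id (singleN γ) c')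
swap-dn-body {γ = γ} {u} {X} w r h with repN-⇐w w r
... | c₀' , r₀ , w₀ with m≤n⇒m<n∨m≡n (transport (_≤ countN X zero) h (countN-⇒w w zero))
... | inj₂ linear = _ , root (repN-dn r₀ (sym linear)) , [ ren-⇒w id (singleN γ) w₀ ]⁺
... | inj₁ shared = rs c₀' γ u , root (repN-cn r₀ shared) , rsˡ w₀ ∷ [ linear-repN-erase γ u r h ]⁺

swap-cn-arg : ∀ {n m n' m'} (C : Ctx cm n (suc m) cm n' m') (t : Obj tm n' m') (γ : Fin m) {u₀ u : Obj tm n m} →
  2 ≤ countN (plug C (named (nEmb C zero) t)) zero → u₀ ⇒w u →
  NeThenW (rs (plug C (named (nEmb C zero) t)) γ u₀)
          (rs (plug C (named (nEmb C (suc γ)) (app t (ren (vEmb C) (nEmb C ∘ suc) u)))) γ u)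
swap-cn-arg C t γ h w =
  _ , root (cn C t γ _ h) , rsˡ (plug-step C (namedₛ (appʳ (ren-⇒w _ _ w)))) ∷ [ rsʳ w ]⁺

swap-dn-arg : ∀ {n m n' m'} (C : Ctx cm n (suc m) cm n' m') (t : Obj tm n' m') (γ : Fin m) {u₀ u : Obj tm n m} →
  countN (plug C (named (nEmb C zero) t)) zero ≡ 1 → u₀ ⇒w u →
  NeThenW (rs (plug C (named (nEmb C zero) t)) γ u₀)
          (ren id (singleN γ) (plug C (named (nEmb C (suc γ)) (app t (ren (vEmb C) (nEmb C ∘ suc) u)))))
swap-dn-arg C t γ h w =
  _ , root (dn C t γ _ h) , [ ren-⇒w id (singleN γ) (plug-step C (namedₛ (appʳ (ren-⇒w _ _ w)))) ]⁺

swap-root : ∀ {s n m} {X Y Z : Obj s n m} → X ⇒w Y → RootNE Y Z → NeThenW X Z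
swap-root (root rw) rn          = swap-w-root rw (root rn)
swap-root (appˡ w) (B L t u)    = swap-B-head L t u w
swap-root (appʳ w) (B L t u)    = swap-B-arg L t w
swap-root (appˡ w) (M L c u)    = swap-M-head L c u w
swap-root (appʳ w) (M L c u)    = swap-M-arg L c w
swap-root (esˡ w) (cv C u h)    = swap-cv-body w (cv-rep C u) h
swap-root (esʳ w) (cv C u h)    = swap-cv-arg C h w
swap-root (esˡ w) (dv C u h)    = swap-dv-body w (cv-rep C u) h
swap-root (esʳ w) (dv C u h)    = swap-dv-arg C h w
swap-root (rsˡ w) (cn C t γ u h) = swap-cn-body w (cn-repN C t γ u) h
swap-root (rsʳ w) (cn C t γ u h) = swap-cn-arg C t γ h w
swap-root (rsˡ w) (dn C t γ u h) = swap-dn-body w (cn-repN C t γ u) h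
swap-root (rsʳ w) (dn C t γ u h) = swap-dn-arg C t γ h w

-- One w-step followed by one non-erasing step: either one step is at the
-- root, or both are in the same immediate subobject (recurse), or they are
-- in disjoint subobjects (they trivially commute).
swap : ∀ {s n m} {X Y Z : Obj s n m} → X ⇒w Y → Y ⇒ne Z → NeThenW X Z
swap w (root rn)                = swap-root w rn
swap (root rw) ne               = swap-w-root rw ne
swap (lamₛ w)   (lamₛ ne)       = plug-NeThenW (lamC hole) (swap w ne)
swap (appˡ w)   (appˡ ne)       = plug-NeThenW (appL hole _) (swap w ne)
swap (appˡ w)   (appʳ ne)       = _ , appʳ ne , [ appˡ w ]⁺
swap (appʳ w)   (appˡ ne)       = _ , appˡ ne , [ appʳ w ]⁺
swap (appʳ w)   (appʳ ne)       = plug-NeThenW (appR _ hole) (swap w ne)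
swap (muₛ w)    (muₛ ne)        = plug-NeThenW (muC hole) (swap w ne)
swap (esˡ w)    (esˡ ne)        = plug-NeThenW (esL hole _) (swap w ne)
swap (esˡ w)    (esʳ ne)        = _ , esʳ ne , [ esˡ w ]⁺
swap (esʳ w)    (esˡ ne)        = _ , esˡ ne , [ esʳ w ]⁺
swap (esʳ w)    (esʳ ne)        = plug-NeThenW (esR _ hole) (swap w ne)
swap (namedₛ w) (namedₛ ne)     = plug-NeThenW (namedC _ hole) (swap w ne)
swap (rsˡ w)    (rsˡ ne)        = plug-NeThenW (rsL hole _ _) (swap w ne)
swap (rsˡ w)    (rsʳ ne)        = _ , rsʳ ne , [ rsˡ w ]⁺
swap (rsʳ w)    (rsˡ ne)        = _ , rsˡ ne , [ rsʳ w ]⁺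
swap (rsʳ w)    (rsʳ ne)        = plug-NeThenW (rsR _ _ hole) (swap w ne)

swap⁺ : ∀ {s n m} {X Y Z : Obj s n m} → X ⇒w⁺ Y → Y ⇒ne Z → NeThenW X Z
swap⁺ [ w ]⁺    ne = swap w ne
swap⁺ (w ∷ ws) ne with swap⁺ ws ne
... | _ , ne₁ , ws₁ with swap w ne₁
... | o₂ , ne₂ , ws₂ = o₂ , ne₂ , ws₂ ++ ws₁

lemma8p2 : ∀ {s n m} (o o' : Obj s n m) →
    (∃ λ o₁ → (o →w⁺ o₁) × (o₁ →ne o')) →
    ∃ λ o₂ → (o →ne o₂) × (o₂ →w⁺ o')
lemma8p2 o o' (o₁ , ws , ne) with swap⁺ (plus-map ctx→step ws) (ctx→step ne)
... | o₂ , ne₂ , ws₂ = o₂ , step→ctx ne₂ , plus-map step→ctx ws₂
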